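{- Let $\phi = \frac{1+\sqrt5}{2}$, $a(j) = \lfloor j\phi\rfloor$, $c(j) = a(j)+2j-1$, and let $S = \{c(j)-1 : j \ge 1\}\cup\{c(j)+1 : j \ge 1\}$, with $s(k)$ the $k$-th smallest element of $S$. Then for every positive integer $k$, $\{s(k)\phi\} = \frac{\sqrt5}{2\phi}\{k\phi\} + b$ for some $b$ (depending on $\{k\phi\}$), where $b \in \{0, \frac{1-\sqrt5}{4}, \frac{5-\sqrt5}{4}\}$ if $k$ is even, and $b \in \{ -\frac12, \frac12, \frac{3-\sqrt5}{4}, 1-\frac{\sqrt5}{2}, 2-\frac{\sqrt5}{2}\}$ if $k$ is odd.
   Context: $\{x\} = x - \lfloor x\rfloor$ denotes the fractional part. -}

module Defs where

open import Data.Nat using (ℕ)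
open import Data.Integer as ℤ using (ℤ; +_; -[1+_])
open import Data.Rational as ℚ using (ℚ; _/_; 0ℚ)
open import Data.Product using (Σ; ∃; _×_; _,_)
open import Data.Sum using (_⊎_)
open import Data.List using (List; length)
open import Data.List.Membership.Propositional using (_∈_)
open import Data.List.Relation.Unary.Unique.Propositional using (Unique)
open import Relation.Binary.PropositionalEquality using (_≡_)
open import Function.Bundles using (_⇔_)

-- Elements of the field ℚ(√5): ⟨ p , q ⟩ stands for p + q·√5.
-- Since √5 is irrational this representation is unique, so ≡ is equality in ℚ(√5).
record Q5 : Set where
  constructor ⟨_,_⟩
  field
    re : ℚ
    ir : ℚ
open Q5

infixl 6 _⊕_ _⊖_
infixl 7 _⊗_

_⊕_ : Q5 → Q5 → Q5
⟨ a , b ⟩ ⊕ ⟨ c , d ⟩ = ⟨ a ℚ.+ c , b ℚ.+ d ⟩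

_⊖_ : Q5 → Q5 → Q5
⟨ a , b ⟩ ⊖ ⟨ c , d ⟩ = ⟨ a ℚ.- c , b ℚ.- d ⟩

-- (a + b√5)(c + d√5) = (ac + 5bd) + (ad + bc)√5
_⊗_ : Q5 → Q5 → Q5
⟨ a , b ⟩ ⊗ ⟨ c , d ⟩ = ⟨ a ℚ.* c ℚ.+ (+ 5 / 1) ℚ.* (b ℚ.* d) , a ℚ.* d ℚ.+ b ℚ.* c ⟩

ι : ℤ → Q5
ι m = ⟨ m / 1 , 0ℚ ⟩

-- p + q√5 ≥ 0 (the usual real order, decided by signs and squares)
NonNeg : Q5 → Set
NonNeg ⟨ p , q ⟩ =
  (0ℚ ℚ.≤ p × 0ℚ ℚ.≤ q)
  ⊎ (0ℚ ℚ.≤ p × q ℚ.< 0ℚ × (+ 5 / 1) ℚ.* (q ℚ.* q) ℚ.≤ p ℚ.* p)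
  ⊎ (p ℚ.< 0ℚ × 0ℚ ℚ.< q × p ℚ.* p ℚ.≤ (+ 5 / 1) ℚ.* (q ℚ.* q))

_≤ᵠ_ : Q5 → Q5 → Set
x ≤ᵠ y = NonNeg (y ⊖ x)

_<ᵠ_ : Q5 → Q5 → Set
x <ᵠ y = x ≤ᵠ y × (x ≡ y → Data.Empty.⊥)
  where import Data.Empty

IsFloor : Q5 → ℤ → Set
IsFloor x m = (ι m ≤ᵠ x) × (x <ᵠ ι (m ℤ.+ + 1))

φ : Q5
φ = ⟨ + 1 / 2 , + 1 / 2 ⟩

IsA : ℤ → ℤ → Set
IsA j m = IsFloor (ι j ⊗ φ) m

cOf : ℤ → ℤ → ℤ
cOf j aj = aj ℤ.+ + 2 ℤ.* j ℤ.- + 1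

InS : ℤ → Set
InS n = ∃ λ j → ∃ λ aj → (+ 1 ℤ.≤ j) × IsA j aj
          × ((n ≡ cOf j aj ℤ.- + 1) ⊎ (n ≡ cOf j aj ℤ.+ + 1))

-- n is the k-th smallest element of S (k ≥ 1): n ∈ S and exactly k-1 elements of S are < n
KthSmallestS : ℕ → ℤ → Set
KthSmallestS k n = InS n × Σ (List ℤ) λ L →
  Unique L × (length L Data.Nat.+ 1 ≡ k) × (∀ x → (x ∈ L) ⇔ (InS x × x ℤ.< n))
  where import Data.Nat

-- the coefficient √5/(2φ) = (5 - √5)/4
coef : Q5
coef = ⟨ + 5 / 4 , -[1+ 0 ] / 4 ⟩

EvenB : Q5 → Set
EvenB b = b ≡ ⟨ 0ℚ , 0ℚ ⟩
        ⊎ b ≡ ⟨ + 1 / 4 , -[1+ 0 ] / 4 ⟩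
        ⊎ b ≡ ⟨ + 5 / 4 , -[1+ 0 ] / 4 ⟩

OddB : Q5 → Set
OddB b = b ≡ ⟨ -[1+ 0 ] / 2 , 0ℚ ⟩
       ⊎ b ≡ ⟨ + 1 / 2 , 0ℚ ⟩
       ⊎ b ≡ ⟨ + 3 / 4 , -[1+ 0 ] / 4 ⟩
       ⊎ b ≡ ⟨ + 1 / 1 , -[1+ 0 ] / 2 ⟩
       ⊎ b ≡ ⟨ + 2 / 1 , -[1+ 0 ] / 2 ⟩

module Submission where

-- Write A = ⌊jφ⌋ and u = 2{jφ} ∈ [0, 2). Because c(j+1) - c(j) = a(j+1) - a(j) + 2 ≥ 3, the elements
-- of S below c(j) ± 1 are the c(i) ± 1 with i < j, so c(j) - 1 is the (2j-1)-th and c(j) + 1 the (2j)-th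
-- element of S. From φ² = φ + 1 and 2·coef = 3 - φ:
--   2j φ = 2A + u,          (A + 2j) φ = (3A + j) + coef·u,
--   (2j - 1) φ = 2A + (u - φ),   (A + 2j - 2) φ = (3A + j) + (coef·u - 2φ).
-- So b = {nφ} - coef {kφ} only depends on the integer parts of u and coef·u (even k), resp. of u - φ and
-- coef·u - 2φ (odd k), and bounding these for u ∈ [0, 2) leaves exactly the listed values of b.
-- All comparisons happen in ℚ(√5), where p + q√5 ≥ 0 is decided by signs and squares of p and q; this cone
-- is closed under + and × and meets its negative only in 0 because √5 is irrational.

open import Defs
open import Data.Nat as ℕ using (ℕ; zero; suc; z≤n; s≤s; _%_)
import Data.Nat.Properties as ℕP
open import Data.Nat.DivMod using ([m+kn]%n≡m%n; m*n%n≡0)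
open import Data.Integer as ℤ using (ℤ; +_; -[1+_])
import Data.Integer.Properties as ℤP
open import Data.Rational as ℚ using (ℚ; 0ℚ; 1ℚ; _/_)
import Data.Rational.Properties as ℚP
open import Data.Product
open import Data.Sum
open import Relation.Nullary
open import Relation.Nullary.Decidable using (from-yes; from-no; map′; _×-dec_; _⊎-dec_; ¬?)
open import Relation.Binary.PropositionalEquality
import Data.Nat.Solver as ℕ-Solver
import Data.Integer.Solver as ℤ-Solver
import Data.Rational.Solver as ℚ-Solver

module SqrtFiveComparison where

  open import Data.Rational using (_+_; _*_; _-_; -_; _≤_; _<_; _≤?_)
  open ℚ-Solver.+-*-Solver
  open ℚP.≤-Reasoning

  five two : ℚ
  five = + 5 / 1
  two = + 2 / 1

  <⇒≱ : ∀ {a b} → a < b → ¬ b ≤ a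
  <⇒≱ a<b b≤a = ℚP.<-irrefl refl (ℚP.<-≤-trans a<b b≤a)

  *-nonNeg : ∀ {a b} → 0ℚ ≤ a → 0ℚ ≤ b → 0ℚ ≤ a * b
  *-nonNeg {a} {b} 0≤a 0≤b =
    ℚP.≤-trans (ℚP.≤-reflexive (sym (ℚP.*-zeroˡ b))) (ℚP.*-monoʳ-≤-nonNeg b {{ℚ.nonNegative 0≤b}} 0≤a)

  *-mono-≤-nonNeg : ∀ {a b c d} → 0ℚ ≤ a → a ≤ b → 0ℚ ≤ c → c ≤ d → a * c ≤ b * d
  *-mono-≤-nonNeg {a} {b} {c} {d} 0≤a a≤b 0≤c c≤d =
    ℚP.≤-trans (ℚP.*-monoʳ-≤-nonNeg c {{ℚ.nonNegative 0≤c}} a≤b)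
               (ℚP.*-monoˡ-≤-nonNeg b {{ℚ.nonNegative (ℚP.≤-trans 0≤a a≤b)}} c≤d)

  square-mono-≤ : ∀ {a b} → 0ℚ ≤ a → a ≤ b → a * a ≤ b * b
  square-mono-≤ 0≤a a≤b = *-mono-≤-nonNeg 0≤a a≤b 0≤a a≤b

  square-mono-< : ∀ {a b} → 0ℚ ≤ a → a < b → a * a < b * b
  square-mono-< {a} {b} 0≤a a<b =
    ℚP.≤-<-trans (ℚP.*-monoˡ-≤-nonNeg a {{ℚ.nonNegative 0≤a}} (ℚP.<⇒≤ a<b))
                 (ℚP.*-monoˡ-<-pos b {{ℚ.positive (ℚP.≤-<-trans 0≤a a<b)}} a<b)

  square-cancel-≤ : ∀ {a b} → 0ℚ ≤ b → a * a ≤ b * b → a ≤ b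
  square-cancel-≤ {a} {b} 0≤b a²≤b² with a ≤? b
  ... | yes a≤b = a≤b
  ... | no a≰b = contradiction a²≤b² (<⇒≱ (square-mono-< 0≤b (ℚP.≰⇒> a≰b)))

  square-nonNeg : ∀ a → 0ℚ ≤ a * a
  square-nonNeg a with 0ℚ ≤? a
  ... | yes 0≤a = *-nonNeg 0≤a 0≤a
  ... | no 0≰a = subst (0ℚ ≤_) (solve 1 (λ x → (:- x) :* (:- x) := x :* x) refl a) (*-nonNeg 0≤-a 0≤-a)
    where 0≤-a = ℚP.neg-antimono-≤ (ℚP.<⇒≤ (ℚP.≰⇒> 0≰a))

  five-nonNeg : 0ℚ ≤ five
  five-nonNeg = ℚ.*≤* (ℤ.+≤+ z≤n)

  five*-mono-≤ : ∀ {a b} → a ≤ b → five * a ≤ five * b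
  five*-mono-≤ = ℚP.*-monoˡ-≤-nonNeg five {{ℚ.nonNegative five-nonNeg}}

  0≤five*square : ∀ a → 0ℚ ≤ five * (a * a)
  0≤five*square a = *-nonNeg five-nonNeg (square-nonNeg a)

  -- a ≤√5· d reads a ≤ √5 d, and √5· e ≤ b reads √5 e ≤ b; both are meant for d, e ≥ 0.
  data _≤√5·_ (a d : ℚ) : Set where
    nonPos  : a ≤ 0ℚ → a ≤√5· d
    squared : a * a ≤ five * (d * d) → a ≤√5· d

  data √5·_≤_ (e b : ℚ) : Set where
    squared : 0ℚ ≤ b → five * (e * e) ≤ b * b → √5· e ≤ b

  ≤√5·-square : ∀ {a d} → 0ℚ < a → a ≤√5· d → a * a ≤ five * (d * d)
  ≤√5·-square 0<a (nonPos a≤0) = contradiction a≤0 (<⇒≱ 0<a)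
  ≤√5·-square 0<a (squared a²≤5d²) = a²≤5d²

  ≤√5·-+-nonPosˡ : ∀ {a₁ a₂ d₁ d₂} → 0ℚ ≤ d₁ → 0ℚ ≤ d₂ → a₁ ≤ 0ℚ → 0ℚ < a₁ + a₂ → a₂ ≤√5· d₂ →
               (a₁ + a₂) * (a₁ + a₂) ≤ five * ((d₁ + d₂) * (d₁ + d₂))
  ≤√5·-+-nonPosˡ {a₁} {a₂} {d₁} {d₂} 0≤d₁ 0≤d₂ a₁≤0 0<s h = begin
    (a₁ + a₂) * (a₁ + a₂)          ≤⟨ square-mono-≤ (ℚP.<⇒≤ 0<s) s≤a₂ ⟩
    a₂ * a₂                        ≤⟨ ≤√5·-square (ℚP.<-≤-trans 0<s s≤a₂) h ⟩
    five * (d₂ * d₂)               ≤⟨ five*-mono-≤ (square-mono-≤ 0≤d₂ d₂≤d) ⟩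
    five * ((d₁ + d₂) * (d₁ + d₂)) ∎
    where
      s≤a₂ = ℚP.≤-trans (ℚP.+-monoˡ-≤ a₂ a₁≤0) (ℚP.≤-reflexive (ℚP.+-identityˡ a₂))
      d₂≤d = ℚP.≤-trans (ℚP.≤-reflexive (sym (ℚP.+-identityˡ d₂))) (ℚP.+-monoˡ-≤ d₂ 0≤d₁)

  ≤√5·-+ : ∀ {a₁ a₂ d₁ d₂} → 0ℚ ≤ d₁ → 0ℚ ≤ d₂ →
           a₁ ≤√5· d₁ → a₂ ≤√5· d₂ → (a₁ + a₂) ≤√5· (d₁ + d₂)
  ≤√5·-+ {a₁} {a₂} {d₁} {d₂} 0≤d₁ 0≤d₂ h₁ h₂ with (a₁ + a₂) ≤? 0ℚ
  ... | yes s≤0 = nonPos s≤0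
  ... | no s≰0 with a₁ ≤? 0ℚ | a₂ ≤? 0ℚ
  ...   | yes a₁≤0 | _ = squared (≤√5·-+-nonPosˡ 0≤d₁ 0≤d₂ a₁≤0 (ℚP.≰⇒> s≰0) h₂)
  ...   | no _ | yes a₂≤0 = squared (subst₂ (λ u v → u * u ≤ five * (v * v)) (ℚP.+-comm a₂ a₁) (ℚP.+-comm d₂ d₁)
            (≤√5·-+-nonPosˡ 0≤d₂ 0≤d₁ a₂≤0 (subst (0ℚ <_) (ℚP.+-comm a₁ a₂) (ℚP.≰⇒> s≰0)) h₁))
  ...   | no a₁≰0 | no a₂≰0 = squared (begin
      (a₁ + a₂) * (a₁ + a₂)                             ≡⟨ solve 2 (λ x y → (x :+ y) :* (x :+ y) := (x :* x :+ y :* y) :+ con two :* (x :* y)) refl a₁ a₂ ⟩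
      (a₁ * a₁ + a₂ * a₂) + two * (a₁ * a₂)               ≤⟨ ℚP.+-mono-≤ (ℚP.+-mono-≤ sq₁ sq₂) (ℚP.*-monoˡ-≤-nonNeg two cross) ⟩
      (five * (d₁ * d₁) + five * (d₂ * d₂)) + two * (five * (d₁ * d₂)) ≡⟨ solve 3 (λ f x y → (f :* (x :* x) :+ f :* (y :* y)) :+ con two :* (f :* (x :* y)) := f :* ((x :+ y) :* (x :+ y))) refl five d₁ d₂ ⟩
      five * ((d₁ + d₂) * (d₁ + d₂))                     ∎)
    where
      sq₁ = ≤√5·-square (ℚP.≰⇒> a₁≰0) h₁
      sq₂ = ≤√5·-square (ℚP.≰⇒> a₂≰0) h₂
      cross : a₁ * a₂ ≤ five * (d₁ * d₂)
      cross = square-cancel-≤ (*-nonNeg five-nonNeg (*-nonNeg 0≤d₁ 0≤d₂)) (begin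
        (a₁ * a₂) * (a₁ * a₂)                           ≡⟨ solve 2 (λ x y → (x :* y) :* (x :* y) := (x :* x) :* (y :* y)) refl a₁ a₂ ⟩
        (a₁ * a₁) * (a₂ * a₂)                           ≤⟨ *-mono-≤-nonNeg (square-nonNeg a₁) sq₁ (square-nonNeg a₂) sq₂ ⟩
        (five * (d₁ * d₁)) * (five * (d₂ * d₂))         ≡⟨ solve 3 (λ f x y → (f :* (x :* x)) :* (f :* (y :* y)) := (f :* (x :* y)) :* (f :* (x :* y))) refl five d₁ d₂ ⟩
        (five * (d₁ * d₂)) * (five * (d₁ * d₂))         ∎)

  √5·≤-+ : ∀ {b₁ b₂ e₁ e₂} → √5· e₁ ≤ b₁ → √5· e₂ ≤ b₂ → √5· (e₁ + e₂) ≤ (b₁ + b₂)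
  √5·≤-+ {b₁} {b₂} {e₁} {e₂} (squared 0≤b₁ h₁) (squared 0≤b₂ h₂) = squared (ℚP.+-mono-≤ 0≤b₁ 0≤b₂) (begin
      five * ((e₁ + e₂) * (e₁ + e₂))                     ≡⟨ solve 3 (λ f x y → f :* ((x :+ y) :* (x :+ y)) := (f :* (x :* x) :+ f :* (y :* y)) :+ con two :* (f :* (x :* y))) refl five e₁ e₂ ⟩
      (five * (e₁ * e₁) + five * (e₂ * e₂)) + two * (five * (e₁ * e₂)) ≤⟨ ℚP.+-mono-≤ (ℚP.+-mono-≤ h₁ h₂) (ℚP.*-monoˡ-≤-nonNeg two cross) ⟩
      (b₁ * b₁ + b₂ * b₂) + two * (b₁ * b₂)               ≡⟨ solve 2 (λ x y → (x :* x :+ y :* y) :+ con two :* (x :* y) := (x :+ y) :* (x :+ y)) refl b₁ b₂ ⟩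
      (b₁ + b₂) * (b₁ + b₂)                             ∎)
    where
      cross : five * (e₁ * e₂) ≤ b₁ * b₂
      cross = square-cancel-≤ (*-nonNeg 0≤b₁ 0≤b₂) (begin
        (five * (e₁ * e₂)) * (five * (e₁ * e₂))         ≡⟨ solve 3 (λ f x y → (f :* (x :* y)) :* (f :* (x :* y)) := (f :* (x :* x)) :* (f :* (y :* y))) refl five e₁ e₂ ⟩
        (five * (e₁ * e₁)) * (five * (e₂ * e₂))         ≤⟨ *-mono-≤-nonNeg (0≤five*square e₁) h₁ (0≤five*square e₂) h₂ ⟩
        (b₁ * b₁) * (b₂ * b₂)                           ≡⟨ solve 2 (λ x y → (x :* x) :* (y :* y) := (x :* y) :* (x :* y)) refl b₁ b₂ ⟩
        (b₁ * b₂) * (b₁ * b₂)                           ∎)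

  -- a ≤ √5 d and √5 e ≤ b give a e ≤ √5 d e ≤ b d.
  ≤√5·-√5·≤-cross : ∀ {a b d e} → 0ℚ ≤ d → 0ℚ ≤ e → a ≤√5· d → √5· e ≤ b → a * e ≤ b * d
  ≤√5·-√5·≤-cross {a} {b} {d} {e} 0≤d 0≤e (nonPos a≤0) (squared 0≤b _) =
    ℚP.≤-trans (ℚP.≤-trans (ℚP.*-monoʳ-≤-nonNeg e {{ℚ.nonNegative 0≤e}} a≤0) (ℚP.≤-reflexive (ℚP.*-zeroˡ e)))
               (*-nonNeg 0≤b 0≤d)
  ≤√5·-√5·≤-cross {a} {b} {d} {e} 0≤d 0≤e (squared a²≤5d²) (squared 0≤b 5e²≤b²) = square-cancel-≤ (*-nonNeg 0≤b 0≤d) (begin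
    (a * e) * (a * e)             ≡⟨ solve 2 (λ x y → (x :* y) :* (x :* y) := (x :* x) :* (y :* y)) refl a e ⟩
    (a * a) * (e * e)             ≤⟨ ℚP.*-monoʳ-≤-nonNeg (e * e) {{ℚ.nonNegative (square-nonNeg e)}} a²≤5d² ⟩
    (five * (d * d)) * (e * e)    ≡⟨ solve 3 (λ f x y → (f :* (x :* x)) :* (y :* y) := (x :* x) :* (f :* (y :* y))) refl five d e ⟩
    (d * d) * (five * (e * e))    ≤⟨ ℚP.*-monoˡ-≤-nonNeg (d * d) {{ℚ.nonNegative (square-nonNeg d)}} 5e²≤b² ⟩
    (d * d) * (b * b)             ≡⟨ solve 2 (λ x y → (x :* x) :* (y :* y) := (y :* x) :* (y :* x)) refl d b ⟩
    (b * d) * (b * d)             ∎)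

  ≤⇒0≤- : ∀ {x y} → x ≤ y → 0ℚ ≤ y - x
  ≤⇒0≤- {x} {y} x≤y = ℚP.≤-trans (ℚP.≤-reflexive (sym (ℚP.+-inverseʳ x))) (ℚP.+-monoˡ-≤ (- x) x≤y)

  0≤-⇒≤ : ∀ {x y} → 0ℚ ≤ y - x → x ≤ y
  0≤-⇒≤ {x} {y} 0≤y-x = ℚP.≤-trans (ℚP.≤-reflexive (sym (ℚP.+-identityˡ x)))
    (ℚP.≤-trans (ℚP.+-monoˡ-≤ x 0≤y-x) (ℚP.≤-reflexive (solve 2 (λ a b → (b :- a) :+ a := b) refl x y)))

  ≤0≤⇒0≤- : ∀ {a b} → a ≤ 0ℚ → 0ℚ ≤ b → 0ℚ ≤ b - a
  ≤0≤⇒0≤- {a} {b} a≤0 0≤b =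
    ℚP.≤-trans 0≤b (ℚP.≤-trans (ℚP.≤-reflexive (sym (ℚP.+-identityʳ b))) (ℚP.+-monoʳ-≤ b (ℚP.neg-antimono-≤ a≤0)))

  nonNeg-≡0 : ∀ {d} → 0ℚ ≤ d → ¬ 0ℚ < d → d ≡ 0ℚ
  nonNeg-≡0 0≤d 0≮d = ℚP.≤-antisym (ℚP.≮⇒≥ 0≮d) 0≤d

  ≤√5·0⇒≤0 : ∀ {a} → a ≤√5· 0ℚ → a ≤ 0ℚ
  ≤√5·0⇒≤0 (nonPos a≤0) = a≤0
  ≤√5·0⇒≤0 {a} (squared a²≤0) with a ≤? 0ℚ
  ... | yes a≤0 = a≤0
  ... | no a≰0 = contradiction a²≤0 (<⇒≱ (square-mono-< ℚP.≤-refl (ℚP.≰⇒> a≰0)))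

  -- Multiplying a - b ≤ √5 (d - e) by d and using the cross inequality b d ≥ a e.
  ≤√5·-− : ∀ {a b d e} → 0ℚ ≤ e → e ≤ d → a ≤√5· d → √5· e ≤ b → (a - b) ≤√5· (d - e)
  ≤√5·-− {a} {b} {d} {e} 0≤e e≤d a≤√5d √5e≤b@(squared 0≤b _) with (a - b) ≤? 0ℚ | 0ℚ ℚ.<? d
  ... | yes a-b≤0 | _ = nonPos a-b≤0
  ... | no a-b≰0 | no 0≮d =
    contradiction (subst (a ≤√5·_) (nonNeg-≡0 0≤d 0≮d) a≤√5d) (λ h → <⇒≱ 0<a (≤√5·0⇒≤0 h))
    where
      0≤d = ℚP.≤-trans 0≤e e≤d
      0<a = ℚP.<-≤-trans (ℚP.≰⇒> a-b≰0)
              (ℚP.≤-trans (ℚP.+-monoʳ-≤ a (ℚP.neg-antimono-≤ 0≤b)) (ℚP.≤-reflexive (ℚP.+-identityʳ a)))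
  ... | no a-b≰0 | yes 0<d = squared (ℚP.*-cancelʳ-≤-pos (d * d) {{ℚ.positive (square-mono-< ℚP.≤-refl 0<d)}} (begin
    ((a - b) * (a - b)) * (d * d)                   ≡⟨ solve 2 (λ x y → (x :* x) :* (y :* y) := (x :* y) :* (x :* y)) refl (a - b) d ⟩
    ((a - b) * d) * ((a - b) * d)                   ≤⟨ square-mono-≤ (*-nonNeg (ℚP.<⇒≤ 0<a-b) (ℚP.<⇒≤ 0<d)) key ⟩
    (a * (d - e)) * (a * (d - e))                   ≡⟨ solve 2 (λ x y → (x :* y) :* (x :* y) := (x :* x) :* (y :* y)) refl a (d - e) ⟩
    (a * a) * ((d - e) * (d - e))                   ≤⟨ ℚP.*-monoʳ-≤-nonNeg ((d - e) * (d - e)) {{ℚ.nonNegative (square-nonNeg (d - e))}} a²≤5d² ⟩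
    (five * (d * d)) * ((d - e) * (d - e))          ≡⟨ solve 3 (λ f x y → (f :* (x :* x)) :* (y :* y) := (f :* (y :* y)) :* (x :* x)) refl five d (d - e) ⟩
    (five * ((d - e) * (d - e))) * (d * d)          ∎))
    where
      0<a-b = ℚP.≰⇒> a-b≰0
      0<a = ℚP.<-≤-trans 0<a-b
              (ℚP.≤-trans (ℚP.+-monoʳ-≤ a (ℚP.neg-antimono-≤ 0≤b)) (ℚP.≤-reflexive (ℚP.+-identityʳ a)))
      a²≤5d² = ≤√5·-square 0<a a≤√5d
      key : (a - b) * d ≤ a * (d - e)
      key = begin
        (a - b) * d      ≡⟨ solve 3 (λ a b d → (a :- b) :* d := a :* d :- b :* d) refl a b d ⟩
        a * d - b * d    ≤⟨ ℚP.+-monoʳ-≤ (a * d) (ℚP.neg-antimono-≤ (≤√5·-√5·≤-cross (ℚP.<⇒≤ 0<d) 0≤e a≤√5d √5e≤b)) ⟩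
        a * d - a * e    ≡⟨ solve 3 (λ a d e → a :* d :- a :* e := a :* (d :- e)) refl a d e ⟩
        a * (d - e)      ∎

  -- Multiplying √5 (e - d) ≤ b - a by e and using the cross inequality b d ≥ a e.
  √5·≤-− : ∀ {a b d e} → 0ℚ ≤ d → d ≤ e → a ≤√5· d → √5· e ≤ b → √5· (e - d) ≤ (b - a)
  √5·≤-− {a} {b} {d} {e} 0≤d d≤e a≤√5d √5e≤b@(squared 0≤b 5e²≤b²) with 0ℚ ℚ.<? e
  ... | no 0≮e = zero-case (nonNeg-≡0 0≤e 0≮e) (nonNeg-≡0 0≤d (λ 0<d → 0≮e (ℚP.<-≤-trans 0<d d≤e)))
    where
      0≤e = ℚP.≤-trans 0≤d d≤e
      zero-case : e ≡ 0ℚ → d ≡ 0ℚ → √5· (e - d) ≤ (b - a)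
      zero-case refl refl = squared (≤0≤⇒0≤- (≤√5·0⇒≤0 a≤√5d) 0≤b) (square-nonNeg (b - a))
  ... | yes 0<e = squared 0≤b-a (ℚP.*-cancelʳ-≤-pos (e * e) {{ℚ.positive (square-mono-< ℚP.≤-refl 0<e)}} (begin
    (five * ((e - d) * (e - d))) * (e * e)          ≡⟨ solve 3 (λ f x y → (f :* (y :* y)) :* (x :* x) := (f :* (x :* x)) :* (y :* y)) refl five e (e - d) ⟩
    (five * (e * e)) * ((e - d) * (e - d))          ≤⟨ ℚP.*-monoʳ-≤-nonNeg ((e - d) * (e - d)) {{ℚ.nonNegative (square-nonNeg (e - d))}} 5e²≤b² ⟩
    (b * b) * ((e - d) * (e - d))                   ≡⟨ solve 2 (λ x y → (x :* x) :* (y :* y) := (x :* y) :* (x :* y)) refl b (e - d) ⟩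
    (b * (e - d)) * (b * (e - d))                   ≤⟨ square-mono-≤ (*-nonNeg 0≤b (≤⇒0≤- d≤e)) key ⟩
    ((b - a) * e) * ((b - a) * e)                   ≡⟨ solve 2 (λ x y → (x :* y) :* (x :* y) := (x :* x) :* (y :* y)) refl (b - a) e ⟩
    ((b - a) * (b - a)) * (e * e)                   ∎))
    where
      ae≤bd = ≤√5·-√5·≤-cross 0≤d (ℚP.<⇒≤ 0<e) a≤√5d √5e≤b
      key : b * (e - d) ≤ (b - a) * e
      key = begin
        b * (e - d)      ≡⟨ solve 3 (λ b e d → b :* (e :- d) := b :* e :- b :* d) refl b e d ⟩
        b * e - b * d    ≤⟨ ℚP.+-monoʳ-≤ (b * e) (ℚP.neg-antimono-≤ ae≤bd) ⟩
        b * e - a * e    ≡⟨ solve 3 (λ b e a → b :* e :- a :* e := (b :- a) :* e) refl b e a ⟩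
        (b - a) * e      ∎
      0≤b-a : 0ℚ ≤ b - a
      0≤b-a with a ≤? 0ℚ
      ... | yes a≤0 = ≤0≤⇒0≤- a≤0 0≤b
      ... | no _ = ≤⇒0≤- {a} {b} (ℚP.*-cancelʳ-≤-pos e {{ℚ.positive 0<e}}
                     (ℚP.≤-trans ae≤bd (ℚP.*-monoˡ-≤-nonNeg b {{ℚ.nonNegative 0≤b}} d≤e)))


module Irrationality where

  open SqrtFiveComparison using (five)

  open import Data.Nat using (_*_; _<_)
  open import Data.Nat.Divisibility using (_∣_; divides)
  open import Data.Nat.Primality using (prime?; euclidsLemma)
  open import Data.Nat.Induction using (<-rec)
  import Data.Rational.Unnormalised as ℚᵘ
  import Data.Rational.Unnormalised.Properties as ℚᵘP

  5∣square⇒5∣ : ∀ a → 5 ∣ a * a → 5 ∣ a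
  5∣square⇒5∣ a 5∣a² = [ id , id ]′ (euclidsLemma a a (from-yes (prime? 5)) 5∣a²)
    where open import Function using (id)

  square≡5*square⇒5∣ : ∀ a b → a * a ≡ 5 * (b * b) → ∃ λ c → a ≡ c * 5 × b * b ≡ 5 * (c * c)
  square≡5*square⇒5∣ a b a²≡5b² with 5∣square⇒5∣ a (divides (b * b) (trans a²≡5b² (ℕP.*-comm 5 (b * b))))
  ... | divides c refl = c , refl , sym (ℕP.*-cancelˡ-≡ _ _ 5
          (trans (solve 1 (λ x → con 5 :* (con 5 :* (x :* x)) := (x :* con 5) :* (x :* con 5)) refl c) a²≡5b²))
    where open ℕ-Solver.+-*-Solver

  -- Infinite descent: a² = 5 b² gives b² = 5 c², hence b = 5 d with c² = 5 d², and d < b unless b = 0.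
  square≡5*square⇒≡0 : ∀ a b → a * a ≡ 5 * (b * b) → b ≡ 0
  square≡5*square⇒≡0 a b = <-rec P descent b a
    where
      P : ℕ → Set
      P b = ∀ a → a * a ≡ 5 * (b * b) → b ≡ 0
      descent : ∀ b → (∀ {d} → d < b → P d) → P b
      descent zero _ _ _ = refl
      descent b@(suc _) ih a a²≡5b² with square≡5*square⇒5∣ a b a²≡5b²
      ... | c , _ , b²≡5c² with square≡5*square⇒5∣ b c b²≡5c²
      ...   | d@(suc _) , b≡5d , c²≡5d² =
              trans b≡5d (cong (ℕ._* 5) (ih (subst (d <_) (sym b≡5d) (ℕP.m<m*n d 5 (s≤s (s≤s z≤n)))) c c²≡5d²))

  -- Clearing denominators of p = a/B, q = c/D turns p² = 5 q² into (a D)² = 5 (c B)² in ℕ (after taking ∣_∣).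
  square≡5*square⇒≡0ℚ : ∀ p q → p ℚ.* p ≡ five ℚ.* (q ℚ.* q) → q ≡ 0ℚ
  square≡5*square⇒≡0ℚ p@(ℚ.mkℚ a b-1 _) q@(ℚ.mkℚ c d-1 _) p²≡5q²
    with ℚᵘP.≃-trans (ℚᵘP.≃-sym (ℚP.toℚᵘ-homo-* p p)) (ℚᵘP.≃-trans (ℚP.toℚᵘ-cong p²≡5q²)
           (ℚᵘP.≃-trans (ℚP.toℚᵘ-homo-* five (q ℚ.* q)) (ℚᵘP.*-cong {ℚ.toℚᵘ five} ℚᵘP.≃-refl (ℚP.toℚᵘ-homo-* q q))))
  ... | ℚᵘ.*≡* cross = ℚP.toℚᵘ-injective (ℚᵘ.*≡* (cong (ℤ._* + 1) c≡0))
    where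
      open ℤ-Solver.+-*-Solver
      B = + suc b-1
      D = + suc d-1
      aD²≡5cB² : (a ℤ.* D) ℤ.* (a ℤ.* D) ≡ + 5 ℤ.* ((c ℤ.* B) ℤ.* (c ℤ.* B))
      aD²≡5cB² = trans (solve 2 (λ x y → (x :* y) :* (x :* y) := (x :* x) :* (con (+ 1) :* (y :* y))) refl a D)
                (trans cross (solve 3 (λ x y z → (z :* (x :* x)) :* (y :* y) := z :* ((x :* y) :* (x :* y))) refl c B (+ 5)))
      ∣aD∣²≡5∣cB∣² : ℤ.∣ a ℤ.* D ∣ * ℤ.∣ a ℤ.* D ∣ ≡ 5 * (ℤ.∣ c ℤ.* B ∣ * ℤ.∣ c ℤ.* B ∣)
      ∣aD∣²≡5∣cB∣² = trans (sym (ℤP.abs-* (a ℤ.* D) (a ℤ.* D))) (trans (cong ℤ.∣_∣ aD²≡5cB²)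
        (trans (ℤP.abs-* (+ 5) ((c ℤ.* B) ℤ.* (c ℤ.* B))) (cong (5 *_) (ℤP.abs-* (c ℤ.* B) (c ℤ.* B)))))
      c≡0 : c ≡ + 0
      c≡0 with ℤP.i*j≡0⇒i≡0∨j≡0 c (ℤP.∣i∣≡0⇒i≡0 (square≡5*square⇒≡0 ℤ.∣ a ℤ.* D ∣ _ ∣aD∣²≡5∣cB∣²))
      ... | inj₁ c≡0 = c≡0


module QuadraticFieldRing where

  open ℚ-Solver.+-*-Solver
  open import Algebra.Structures using (IsCommutativeRing)
  open import Algebra.Bundles using (CommutativeRing)
  import Algebra.Solver.Ring.AlmostCommutativeRing as ACR
  import Algebra.Solver.Ring.Simple as Simple

  ⟨⟩-cong : ∀ {x y : Q5} → Q5.re x ≡ Q5.re y → Q5.ir x ≡ Q5.ir y → x ≡ y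
  ⟨⟩-cong = cong₂ ⟨_,_⟩

  ⊝_ : Q5 → Q5
  ⊝ ⟨ a , b ⟩ = ⟨ ℚ.- a , ℚ.- b ⟩

  0ᵠ 1ᵠ : Q5
  0ᵠ = ⟨ 0ℚ , 0ℚ ⟩
  1ᵠ = ⟨ 1ℚ , 0ℚ ⟩

  private
    five : ℚ
    five = + 5 / 1

    re ir : Q5 → ℚ
    re = Q5.re
    ir = Q5.ir

  ⊕-assoc : ∀ x y z → (x ⊕ y) ⊕ z ≡ x ⊕ (y ⊕ z)
  ⊕-assoc x y z = ⟨⟩-cong (ℚP.+-assoc (re x) (re y) (re z)) (ℚP.+-assoc (ir x) (ir y) (ir z))

  ⊕-comm : ∀ x y → x ⊕ y ≡ y ⊕ x
  ⊕-comm x y = ⟨⟩-cong (ℚP.+-comm (re x) (re y)) (ℚP.+-comm (ir x) (ir y))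

  ⊕-identityˡ : ∀ x → 0ᵠ ⊕ x ≡ x
  ⊕-identityˡ x = ⟨⟩-cong (ℚP.+-identityˡ (re x)) (ℚP.+-identityˡ (ir x))

  ⊕-identityʳ : ∀ x → x ⊕ 0ᵠ ≡ x
  ⊕-identityʳ x = ⟨⟩-cong (ℚP.+-identityʳ (re x)) (ℚP.+-identityʳ (ir x))

  ⊕-inverseˡ : ∀ x → (⊝ x) ⊕ x ≡ 0ᵠ
  ⊕-inverseˡ x = ⟨⟩-cong (ℚP.+-inverseˡ (re x)) (ℚP.+-inverseˡ (ir x))

  ⊕-inverseʳ : ∀ x → x ⊕ (⊝ x) ≡ 0ᵠ
  ⊕-inverseʳ x = ⟨⟩-cong (ℚP.+-inverseʳ (re x)) (ℚP.+-inverseʳ (ir x))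

  ⊗-assoc : ∀ x y z → (x ⊗ y) ⊗ z ≡ x ⊗ (y ⊗ z)
  ⊗-assoc x y z = ⟨⟩-cong
    (solve 7 (λ f a b c d e g → (a :* c :+ f :* (b :* d)) :* e :+ f :* ((a :* d :+ b :* c) :* g)
                             := a :* (c :* e :+ f :* (d :* g)) :+ f :* (b :* (c :* g :+ d :* e)))
           refl five (re x) (ir x) (re y) (ir y) (re z) (ir z))
    (solve 7 (λ f a b c d e g → (a :* c :+ f :* (b :* d)) :* g :+ (a :* d :+ b :* c) :* e
                             := a :* (c :* g :+ d :* e) :+ b :* (c :* e :+ f :* (d :* g)))
           refl five (re x) (ir x) (re y) (ir y) (re z) (ir z))

  ⊗-comm : ∀ x y → x ⊗ y ≡ y ⊗ x
  ⊗-comm x y = ⟨⟩-cong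
    (solve 5 (λ f a b c d → a :* c :+ f :* (b :* d) := c :* a :+ f :* (d :* b)) refl five (re x) (ir x) (re y) (ir y))
    (solve 4 (λ a b c d → a :* d :+ b :* c := c :* b :+ d :* a) refl (re x) (ir x) (re y) (ir y))

  ⊗-identityˡ : ∀ x → 1ᵠ ⊗ x ≡ x
  ⊗-identityˡ x = ⟨⟩-cong
    (solve 3 (λ f a b → con 1ℚ :* a :+ f :* (con 0ℚ :* b) := a) refl five (re x) (ir x))
    (solve 2 (λ a b → con 1ℚ :* b :+ con 0ℚ :* a := b) refl (re x) (ir x))

  ⊗-identityʳ : ∀ x → x ⊗ 1ᵠ ≡ x
  ⊗-identityʳ x = trans (⊗-comm x 1ᵠ) (⊗-identityˡ x)

  ⊗-distribˡ-⊕ : ∀ x y z → x ⊗ (y ⊕ z) ≡ (x ⊗ y) ⊕ (x ⊗ z)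
  ⊗-distribˡ-⊕ x y z = ⟨⟩-cong
    (solve 7 (λ f a b c d e g → a :* (c :+ e) :+ f :* (b :* (d :+ g))
                             := (a :* c :+ f :* (b :* d)) :+ (a :* e :+ f :* (b :* g)))
           refl five (re x) (ir x) (re y) (ir y) (re z) (ir z))
    (solve 6 (λ a b c d e g → a :* (d :+ g) :+ b :* (c :+ e) := (a :* d :+ b :* c) :+ (a :* g :+ b :* e))
           refl (re x) (ir x) (re y) (ir y) (re z) (ir z))

  ⊗-distribʳ-⊕ : ∀ x y z → (y ⊕ z) ⊗ x ≡ (y ⊗ x) ⊕ (z ⊗ x)
  ⊗-distribʳ-⊕ x y z = trans (⊗-comm (y ⊕ z) x) (trans (⊗-distribˡ-⊕ x y z) (cong₂ _⊕_ (⊗-comm x y) (⊗-comm x z)))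

  ⊕-⊗-isCommutativeRing : IsCommutativeRing _≡_ _⊕_ _⊗_ ⊝_ 0ᵠ 1ᵠ
  ⊕-⊗-isCommutativeRing = record
    { isRing = record
      { +-isAbelianGroup = record
        { isGroup = record
          { isMonoid = record
            { isSemigroup = record
              { isMagma = record { isEquivalence = isEquivalence ; ∙-cong = cong₂ _⊕_ }
              ; assoc = ⊕-assoc }
            ; identity = ⊕-identityˡ , ⊕-identityʳ }
          ; inverse = ⊕-inverseˡ , ⊕-inverseʳ
          ; ⁻¹-cong = cong ⊝_ }
        ; comm = ⊕-comm }
      ; *-cong = cong₂ _⊗_
      ; *-assoc = ⊗-assoc
      ; *-identity = ⊗-identityˡ , ⊗-identityʳ
      ; distrib = ⊗-distribˡ-⊕ , ⊗-distribʳ-⊕ }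
    ; *-comm = ⊗-comm }

  ⊕-⊗-commutativeRing : CommutativeRing _ _
  ⊕-⊗-commutativeRing = record { isCommutativeRing = ⊕-⊗-isCommutativeRing }

  _≟ᵠ_ : (x y : Q5) → Dec (x ≡ y)
  ⟨ a , b ⟩ ≟ᵠ ⟨ c , d ⟩ = map′ (uncurry (cong₂ ⟨_,_⟩)) (λ e → cong Q5.re e , cong Q5.ir e) ((a ℚP.≟ c) ×-dec (b ℚP.≟ d))

  module Q5-Solver = Simple (ACR.fromCommutativeRing ⊕-⊗-commutativeRing) _≟ᵠ_


module IntegerEmbedding where

  open QuadraticFieldRing using (⟨⟩-cong; ⊝_)
  import Data.Nat.Coprimality as Coprimality
  open ℚ-Solver.+-*-Solver

  -- m / 1 normalises through gcd; [ m /1] is the same rational built directly, so ℚ arithmetic on it computes.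
  [_/1] : ℤ → ℚ
  [ m /1] = ℚ.mkℚ m 0 (Coprimality.sym (Coprimality.1-coprimeTo ℤ.∣ m ∣))

  /1≡mkℚ : ∀ m → m / 1 ≡ [ m /1]
  /1≡mkℚ m = ℚP.↥p/↧p≡p [ m /1]

  /1-+ : ∀ m n → (m ℤ.+ n) / 1 ≡ (m / 1) ℚ.+ (n / 1)
  /1-+ m n rewrite /1≡mkℚ m | /1≡mkℚ n =
    cong (λ z → z / 1) (sym (cong₂ ℤ._+_ (ℤP.*-identityʳ m) (ℤP.*-identityʳ n)))

  /1-* : ∀ m n → (m ℤ.* n) / 1 ≡ (m / 1) ℚ.* (n / 1)
  /1-* m n rewrite /1≡mkℚ m | /1≡mkℚ n = refl

  /1-neg : ∀ m → (ℤ.- m) / 1 ≡ ℚ.- (m / 1)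
  /1-neg m rewrite /1≡mkℚ m | /1≡mkℚ (ℤ.- m) = neg-mkℚ m
    where
      neg-mkℚ : ∀ m → [ ℤ.- m /1] ≡ ℚ.- [ m /1]
      neg-mkℚ (+ zero) = refl
      neg-mkℚ (+ suc n) = refl
      neg-mkℚ -[1+ n ] = refl

  /1-cancel-≤ : ∀ {m n} → m / 1 ℚ.≤ n / 1 → m ℤ.≤ n
  /1-cancel-≤ {m} {n} m≤n rewrite /1≡mkℚ m | /1≡mkℚ n with m≤n
  ... | ℚ.*≤* m*1≤n*1 = subst₂ ℤ._≤_ (ℤP.*-identityʳ m) (ℤP.*-identityʳ n) m*1≤n*1

  ι-+ : ∀ m n → ι (m ℤ.+ n) ≡ ι m ⊕ ι n
  ι-+ m n = ⟨⟩-cong (/1-+ m n) refl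

  ι-* : ∀ m n → ι (m ℤ.* n) ≡ ι m ⊗ ι n
  ι-* m n = ⟨⟩-cong
    (trans (/1-* m n) (solve 2 (λ x y → x :* y := x :* y :+ con (+ 5 / 1) :* (con 0ℚ :* con 0ℚ)) refl (m / 1) (n / 1)))
    (solve 2 (λ x y → con 0ℚ := x :* con 0ℚ :+ con 0ℚ :* y) refl (m / 1) (n / 1))

  ι-neg : ∀ m → ι (ℤ.- m) ≡ ⊝ ι m
  ι-neg m = ⟨⟩-cong (/1-neg m) refl

  ι-- : ∀ m n → ι (m ℤ.- n) ≡ ι m ⊖ ι n
  ι-- m n = trans (ι-+ m (ℤ.- n)) (cong (ι m ⊕_) (ι-neg n))

  ι-injective : ∀ {m n} → ι m ≡ ι n → m ≡ n
  ι-injective ιm≡ιn = ℤP.≤-antisym (/1-cancel-≤ (ℚP.≤-reflexive (cong Q5.re ιm≡ιn)))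
                                   (/1-cancel-≤ (ℚP.≤-reflexive (sym (cong Q5.re ιm≡ιn))))


module PositiveCone where

  open SqrtFiveComparison
  open Irrationality using (square≡5*square⇒≡0ℚ)
  open QuadraticFieldRing using (⊝_; 0ᵠ)
  open import Data.Rational using (_+_; _*_; _-_; -_; _≤_; _<_; _≤?_; _<?_)
  open ℚ-Solver.+-*-Solver
  open ℚP.≤-Reasoning

  neg*neg : ∀ a → (- a) * (- a) ≡ a * a
  neg*neg = solve 1 (λ x → (:- x) :* (:- x) := x :* x) refl

  neg-involutive : ∀ a → - (- a) ≡ a
  neg-involutive = solve 1 (λ x → :- (:- x) := x) refl

  0≤-⇒≤0 : ∀ {a} → 0ℚ ≤ - a → a ≤ 0ℚ
  0≤-⇒≤0 {a} 0≤-a = subst (_≤ 0ℚ) (neg-involutive a) (ℚP.neg-antimono-≤ 0≤-a)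

  -≤0⇒0≤ : ∀ {a} → - a ≤ 0ℚ → 0ℚ ≤ a
  -≤0⇒0≤ {a} -a≤0 = subst (0ℚ ≤_) (neg-involutive a) (ℚP.neg-antimono-≤ -a≤0)

  -- p + q√5 ≥ 0, read as -p ≤ √5 q when q ≥ 0 and as √5 (-q) ≤ p when q ≤ 0.
  NonNegBySign : ℚ → ℚ → Set
  NonNegBySign p q = (0ℚ ≤ q × (- p) ≤√5· q) ⊎ (q ≤ 0ℚ × √5· (- q) ≤ p)

  NonNeg⇒bySign : ∀ p q → NonNeg ⟨ p , q ⟩ → NonNegBySign p q
  NonNeg⇒bySign p q (inj₁ (0≤p , 0≤q)) = inj₁ (0≤q , nonPos (ℚP.neg-antimono-≤ 0≤p))
  NonNeg⇒bySign p q (inj₂ (inj₁ (0≤p , q<0 , 5q²≤p²))) =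
    inj₂ (ℚP.<⇒≤ q<0 , squared 0≤p (subst (λ z → five * z ≤ p * p) (sym (neg*neg q)) 5q²≤p²))
  NonNeg⇒bySign p q (inj₂ (inj₂ (p<0 , 0<q , p²≤5q²))) =
    inj₁ (ℚP.<⇒≤ 0<q , squared (subst (_≤ five * (q * q)) (sym (neg*neg p)) p²≤5q²))

  bySign⇒NonNeg : ∀ p q → NonNegBySign p q → NonNeg ⟨ p , q ⟩
  bySign⇒NonNeg p q (inj₁ (0≤q , nonPos -p≤0)) = inj₁ (-≤0⇒0≤ -p≤0 , 0≤q)
  bySign⇒NonNeg p q (inj₁ (0≤q , squared p²≤5q²)) with 0ℚ ≤? p | 0ℚ <? q
  ... | yes 0≤p | _ = inj₁ (0≤p , 0≤q)
  ... | no 0≰p | yes 0<q = inj₂ (inj₂ (ℚP.≰⇒> 0≰p , 0<q , subst (_≤ five * (q * q)) (neg*neg p) p²≤5q²))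
  ... | no 0≰p | no 0≮q = contradiction (subst (λ z → (- p) ≤√5· z) (nonNeg-≡0 0≤q 0≮q) (squared p²≤5q²))
                            (λ h → <⇒≱ (ℚP.neg-antimono-< (ℚP.≰⇒> 0≰p)) (≤√5·0⇒≤0 h))
  bySign⇒NonNeg p q (inj₂ (q≤0 , squared 0≤p 5q²≤p²)) with q <? 0ℚ
  ... | yes q<0 = inj₂ (inj₁ (0≤p , q<0 , subst (λ z → five * z ≤ p * p) (neg*neg q) 5q²≤p²))
  ... | no q≮0 = inj₁ (0≤p , ℚP.≮⇒≥ q≮0)

  bySign-+ : ∀ {p₁ q₁ p₂ q₂} → NonNegBySign p₁ q₁ → NonNegBySign p₂ q₂ → NonNegBySign (p₁ + p₂) (q₁ + q₂)
  bySign-+ {p₁} {q₁} {p₂} {q₂} (inj₁ (0≤q₁ , h₁)) (inj₁ (0≤q₂ , h₂)) =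
    inj₁ (ℚP.+-mono-≤ 0≤q₁ 0≤q₂ , subst (_≤√5· (q₁ + q₂)) (sym (ℚP.neg-distrib-+ p₁ p₂)) (≤√5·-+ 0≤q₁ 0≤q₂ h₁ h₂))
  bySign-+ {p₁} {q₁} {p₂} {q₂} (inj₂ (q₁≤0 , h₁)) (inj₂ (q₂≤0 , h₂)) =
    inj₂ (ℚP.+-mono-≤ q₁≤0 q₂≤0 , subst (λ z → √5· z ≤ (p₁ + p₂)) (sym (ℚP.neg-distrib-+ q₁ q₂)) (√5·≤-+ h₁ h₂))
  bySign-+ {p₁} {q₁} {p₂} {q₂} (inj₁ (0≤q₁ , h₁)) (inj₂ (q₂≤0 , h₂)) with (- q₂) ≤? q₁
  ... | yes -q₂≤q₁ = inj₁ (subst (0ℚ ≤_) q₁--q₂ (≤⇒0≤- -q₂≤q₁) ,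
          subst₂ _≤√5·_ (solve 2 (λ a b → (:- a) :- b := :- (a :+ b)) refl p₁ p₂) q₁--q₂
            (≤√5·-− (ℚP.neg-antimono-≤ q₂≤0) -q₂≤q₁ h₁ h₂))
    where q₁--q₂ = solve 2 (λ a b → a :- (:- b) := a :+ b) refl q₁ q₂
  ... | no -q₂≰q₁ = inj₂ (0≤-⇒≤0 (subst (0ℚ ≤_) -q₂-q₁ (≤⇒0≤- q₁≤-q₂)) ,
          subst₂ √5·_≤_ -q₂-q₁ (solve 2 (λ a b → b :- (:- a) := a :+ b) refl p₁ p₂) (√5·≤-− 0≤q₁ q₁≤-q₂ h₁ h₂))
    where
      q₁≤-q₂ = ℚP.<⇒≤ (ℚP.≰⇒> -q₂≰q₁)
      -q₂-q₁ = solve 2 (λ a b → (:- b) :- a := :- (a :+ b)) refl q₁ q₂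
  bySign-+ {p₁} {q₁} {p₂} {q₂} h₁@(inj₂ _) h₂@(inj₁ _) =
    subst₂ NonNegBySign (ℚP.+-comm p₂ p₁) (ℚP.+-comm q₂ q₁) (bySign-+ h₂ h₁)

  NonNeg-⊕ : ∀ x y → NonNeg x → NonNeg y → NonNeg (x ⊕ y)
  NonNeg-⊕ ⟨ p₁ , q₁ ⟩ ⟨ p₂ , q₂ ⟩ x≥0 y≥0 = bySign⇒NonNeg _ _ (bySign-+ (NonNeg⇒bySign p₁ q₁ x≥0) (NonNeg⇒bySign p₂ q₂ y≥0))

  -- p + q√5 ≥ 0, read as p ≥ 0 when |p| ≥ √5 |q| and as q ≥ 0 when |p| ≤ √5 |q|.
  NonNegByDominant : ℚ → ℚ → Set
  NonNegByDominant p q = (0ℚ ≤ p × five * (q * q) ≤ p * p) ⊎ (0ℚ ≤ q × p * p ≤ five * (q * q))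

  NonNeg⇒byDominant : ∀ p q → NonNeg ⟨ p , q ⟩ → NonNegByDominant p q
  NonNeg⇒byDominant p q h with NonNeg⇒bySign p q h
  ... | inj₁ (0≤q , nonPos -p≤0) with (five * (q * q)) ≤? (p * p)
  ...   | yes 5q²≤p² = inj₁ (-≤0⇒0≤ -p≤0 , 5q²≤p²)
  ...   | no 5q²≰p² = inj₂ (0≤q , ℚP.<⇒≤ (ℚP.≰⇒> 5q²≰p²))
  NonNeg⇒byDominant p q h | inj₁ (0≤q , squared p²≤5q²) = inj₂ (0≤q , subst (_≤ five * (q * q)) (neg*neg p) p²≤5q²)
  NonNeg⇒byDominant p q h | inj₂ (_ , squared 0≤p 5q²≤p²) = inj₁ (0≤p , subst (λ z → five * z ≤ p * p) (neg*neg q) 5q²≤p²)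

  byDominant⇒NonNeg : ∀ p q → NonNegByDominant p q → NonNeg ⟨ p , q ⟩
  byDominant⇒NonNeg p q (inj₁ (0≤p , 5q²≤p²)) with 0ℚ ≤? q
  ... | yes 0≤q = inj₁ (0≤p , 0≤q)
  ... | no 0≰q = inj₂ (inj₁ (0≤p , ℚP.≰⇒> 0≰q , 5q²≤p²))
  byDominant⇒NonNeg p q (inj₂ (0≤q , p²≤5q²)) =
    bySign⇒NonNeg p q (inj₁ (0≤q , squared (subst (_≤ five * (q * q)) (sym (neg*neg p)) p²≤5q²)))

  -- The norm p² - 5q² is multiplicative; its sign tells which part of the product dominates.
  byDominant-*-re-re : ∀ {p₁ q₁ p₂ q₂} → 0ℚ ≤ p₁ → five * (q₁ * q₁) ≤ p₁ * p₁ → 0ℚ ≤ p₂ → five * (q₂ * q₂) ≤ p₂ * p₂ →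
                       NonNegByDominant (p₁ * p₂ + five * (q₁ * q₂)) (p₁ * q₂ + q₁ * p₂)
  byDominant-*-re-re {p₁} {q₁} {p₂} {q₂} 0≤p₁ h₁ 0≤p₂ h₂ = inj₁ (0≤re , 0≤-⇒≤ norm≥0)
    where
      -5q₁q₂≤p₁p₂ : - (five * (q₁ * q₂)) ≤ p₁ * p₂
      -5q₁q₂≤p₁p₂ = square-cancel-≤ (*-nonNeg 0≤p₁ 0≤p₂) (begin
        (- (five * (q₁ * q₂))) * (- (five * (q₁ * q₂))) ≡⟨ solve 3 (λ f a b → (:- (f :* (a :* b))) :* (:- (f :* (a :* b))) := (f :* (a :* a)) :* (f :* (b :* b))) refl five q₁ q₂ ⟩
        (five * (q₁ * q₁)) * (five * (q₂ * q₂))         ≤⟨ *-mono-≤-nonNeg (0≤five*square q₁) h₁ (0≤five*square q₂) h₂ ⟩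
        (p₁ * p₁) * (p₂ * p₂)                           ≡⟨ solve 2 (λ a b → (a :* a) :* (b :* b) := (a :* b) :* (a :* b)) refl p₁ p₂ ⟩
        (p₁ * p₂) * (p₁ * p₂)                           ∎)
      0≤re = subst (0ℚ ≤_) (solve 3 (λ a f b → a :- (:- (f :* b)) := a :+ f :* b) refl (p₁ * p₂) five (q₁ * q₂)) (≤⇒0≤- -5q₁q₂≤p₁p₂)
      norm≥0 = subst (0ℚ ≤_)
        (solve 5 (λ f a b c d → (a :* a :- f :* (b :* b)) :* (c :* c :- f :* (d :* d)) :=
                  (a :* c :+ f :* (b :* d)) :* (a :* c :+ f :* (b :* d)) :- f :* ((a :* d :+ b :* c) :* (a :* d :+ b :* c)))
               refl five p₁ q₁ p₂ q₂)
        (*-nonNeg (≤⇒0≤- h₁) (≤⇒0≤- h₂))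

  byDominant-*-ir-ir : ∀ {p₁ q₁ p₂ q₂} → 0ℚ ≤ q₁ → p₁ * p₁ ≤ five * (q₁ * q₁) → 0ℚ ≤ q₂ → p₂ * p₂ ≤ five * (q₂ * q₂) →
                       NonNegByDominant (p₁ * p₂ + five * (q₁ * q₂)) (p₁ * q₂ + q₁ * p₂)
  byDominant-*-ir-ir {p₁} {q₁} {p₂} {q₂} 0≤q₁ h₁ 0≤q₂ h₂ = inj₁ (0≤re , 0≤-⇒≤ norm≥0)
    where
      -p₁p₂≤5q₁q₂ : - (p₁ * p₂) ≤ five * (q₁ * q₂)
      -p₁p₂≤5q₁q₂ = square-cancel-≤ (*-nonNeg five-nonNeg (*-nonNeg 0≤q₁ 0≤q₂)) (begin
        (- (p₁ * p₂)) * (- (p₁ * p₂))                   ≡⟨ solve 2 (λ a b → (:- (a :* b)) :* (:- (a :* b)) := (a :* a) :* (b :* b)) refl p₁ p₂ ⟩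
        (p₁ * p₁) * (p₂ * p₂)                           ≤⟨ *-mono-≤-nonNeg (square-nonNeg p₁) h₁ (square-nonNeg p₂) h₂ ⟩
        (five * (q₁ * q₁)) * (five * (q₂ * q₂))         ≡⟨ solve 3 (λ f a b → (f :* (a :* a)) :* (f :* (b :* b)) := (f :* (a :* b)) :* (f :* (a :* b))) refl five q₁ q₂ ⟩
        (five * (q₁ * q₂)) * (five * (q₁ * q₂))         ∎)
      0≤re = subst (0ℚ ≤_) (solve 2 (λ a b → b :- (:- a) := a :+ b) refl (p₁ * p₂) (five * (q₁ * q₂))) (≤⇒0≤- -p₁p₂≤5q₁q₂)
      norm≥0 = subst (0ℚ ≤_)
        (solve 5 (λ f a b c d → (f :* (b :* b) :- a :* a) :* (f :* (d :* d) :- c :* c) :=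
                  (a :* c :+ f :* (b :* d)) :* (a :* c :+ f :* (b :* d)) :- f :* ((a :* d :+ b :* c) :* (a :* d :+ b :* c)))
               refl five p₁ q₁ p₂ q₂)
        (*-nonNeg (≤⇒0≤- h₁) (≤⇒0≤- h₂))

  byDominant-*-re-ir : ∀ {p₁ q₁ p₂ q₂} → 0ℚ ≤ p₁ → five * (q₁ * q₁) ≤ p₁ * p₁ → 0ℚ ≤ q₂ → p₂ * p₂ ≤ five * (q₂ * q₂) →
                       NonNegByDominant (p₁ * p₂ + five * (q₁ * q₂)) (p₁ * q₂ + q₁ * p₂)
  byDominant-*-re-ir {p₁} {q₁} {p₂} {q₂} 0≤p₁ h₁ 0≤q₂ h₂ = inj₂ (0≤ir , 0≤-⇒≤ norm≤0)
    where
      -q₁p₂≤p₁q₂ : - (q₁ * p₂) ≤ p₁ * q₂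
      -q₁p₂≤p₁q₂ = square-cancel-≤ (*-nonNeg 0≤p₁ 0≤q₂) (begin
        (- (q₁ * p₂)) * (- (q₁ * p₂))                   ≡⟨ solve 2 (λ a b → (:- (a :* b)) :* (:- (a :* b)) := (a :* a) :* (b :* b)) refl q₁ p₂ ⟩
        (q₁ * q₁) * (p₂ * p₂)                           ≤⟨ ℚP.*-monoˡ-≤-nonNeg (q₁ * q₁) {{ℚ.nonNegative (square-nonNeg q₁)}} h₂ ⟩
        (q₁ * q₁) * (five * (q₂ * q₂))                  ≡⟨ solve 3 (λ f a b → (a :* a) :* (f :* (b :* b)) := (f :* (a :* a)) :* (b :* b)) refl five q₁ q₂ ⟩
        (five * (q₁ * q₁)) * (q₂ * q₂)                  ≤⟨ ℚP.*-monoʳ-≤-nonNeg (q₂ * q₂) {{ℚ.nonNegative (square-nonNeg q₂)}} h₁ ⟩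
        (p₁ * p₁) * (q₂ * q₂)                           ≡⟨ solve 2 (λ a b → (a :* a) :* (b :* b) := (a :* b) :* (a :* b)) refl p₁ q₂ ⟩
        (p₁ * q₂) * (p₁ * q₂)                           ∎)
      0≤ir = subst (0ℚ ≤_) (solve 2 (λ a b → a :- (:- b) := a :+ b) refl (p₁ * q₂) (q₁ * p₂)) (≤⇒0≤- -q₁p₂≤p₁q₂)
      norm≤0 = subst (0ℚ ≤_)
        (solve 5 (λ f a b c d → (a :* a :- f :* (b :* b)) :* (f :* (d :* d) :- c :* c) :=
                  f :* ((a :* d :+ b :* c) :* (a :* d :+ b :* c)) :- (a :* c :+ f :* (b :* d)) :* (a :* c :+ f :* (b :* d)))
               refl five p₁ q₁ p₂ q₂)
        (*-nonNeg (≤⇒0≤- h₁) (≤⇒0≤- h₂))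

  byDominant-* : ∀ {p₁ q₁ p₂ q₂} → NonNegByDominant p₁ q₁ → NonNegByDominant p₂ q₂ →
                 NonNegByDominant (p₁ * p₂ + five * (q₁ * q₂)) (p₁ * q₂ + q₁ * p₂)
  byDominant-* {p₁} {q₁} {p₂} {q₂} (inj₁ (a , b)) (inj₁ (c , d)) = byDominant-*-re-re {p₁} {q₁} {p₂} {q₂} a b c d
  byDominant-* {p₁} {q₁} {p₂} {q₂} (inj₂ (a , b)) (inj₂ (c , d)) = byDominant-*-ir-ir {p₁} {q₁} {p₂} {q₂} a b c d
  byDominant-* {p₁} {q₁} {p₂} {q₂} (inj₁ (a , b)) (inj₂ (c , d)) = byDominant-*-re-ir {p₁} {q₁} {p₂} {q₂} a b c d
  byDominant-* {p₁} {q₁} {p₂} {q₂} (inj₂ (a , b)) (inj₁ (c , d)) =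
    subst₂ NonNegByDominant
      (solve 4 (λ a b c d → c :* a :+ con five :* (d :* b) := a :* c :+ con five :* (b :* d)) refl p₁ q₁ p₂ q₂)
      (solve 4 (λ a b c d → c :* b :+ d :* a := a :* d :+ b :* c) refl p₁ q₁ p₂ q₂)
      (byDominant-*-re-ir {p₂} {q₂} {p₁} {q₁} c d a b)

  NonNeg-⊗ : ∀ x y → NonNeg x → NonNeg y → NonNeg (x ⊗ y)
  NonNeg-⊗ ⟨ p₁ , q₁ ⟩ ⟨ p₂ , q₂ ⟩ x≥0 y≥0 =
    byDominant⇒NonNeg _ _ (byDominant-* (NonNeg⇒byDominant p₁ q₁ x≥0) (NonNeg⇒byDominant p₂ q₂ y≥0))

  NonNeg? : ∀ x → Dec (NonNeg x)
  NonNeg? ⟨ p , q ⟩ =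
    ((0ℚ ≤? p) ×-dec (0ℚ ≤? q))
    ⊎-dec (((0ℚ ≤? p) ×-dec ((q <? 0ℚ) ×-dec ((five * (q * q)) ≤? (p * p))))
    ⊎-dec ((p <? 0ℚ) ×-dec ((0ℚ <? q) ×-dec ((p * p) ≤? (five * (q * q))))))

  NonNeg-total : ∀ x → ¬ NonNeg x → NonNeg (⊝ x)
  NonNeg-total ⟨ p , q ⟩ x≱0 = byDominant⇒NonNeg _ _ -x-dominant
    where
      -x-dominant : NonNegByDominant (- p) (- q)
      -x-dominant with (five * (q * q)) ≤? (p * p) | 0ℚ ≤? p | 0ℚ ≤? q
      ... | yes 5q²≤p² | yes 0≤p | _ = contradiction (byDominant⇒NonNeg p q (inj₁ (0≤p , 5q²≤p²))) x≱0
      ... | yes 5q²≤p² | no 0≰p | _ =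
        inj₁ (ℚP.<⇒≤ (ℚP.neg-antimono-< (ℚP.≰⇒> 0≰p)) , subst₂ (λ u v → five * u ≤ v) (sym (neg*neg q)) (sym (neg*neg p)) 5q²≤p²)
      ... | no 5q²≰p² | _ | yes 0≤q = contradiction (byDominant⇒NonNeg p q (inj₂ (0≤q , ℚP.<⇒≤ (ℚP.≰⇒> 5q²≰p²)))) x≱0
      ... | no 5q²≰p² | _ | no 0≰q =
        inj₂ (ℚP.<⇒≤ (ℚP.neg-antimono-< (ℚP.≰⇒> 0≰q)) ,
              subst₂ (λ u v → u ≤ five * v) (sym (neg*neg p)) (sym (neg*neg q)) (ℚP.<⇒≤ (ℚP.≰⇒> 5q²≰p²)))

  -- x ≥ 0 and -x ≥ 0 force p² = 5 q², so q = 0 by irrationality, and then p = 0.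
  NonNeg-antisym : ∀ x → NonNeg x → NonNeg (⊝ x) → x ≡ 0ᵠ
  NonNeg-antisym ⟨ p , q ⟩ x≥0 -x≥0 = cong₂ ⟨_,_⟩ p≡0 q≡0
    where
      unneg² : ∀ a b → (- a) * (- a) ≤ five * ((- b) * (- b)) → a * a ≤ five * (b * b)
      unneg² a b = subst₂ (λ u v → u ≤ five * v) (neg*neg a) (neg*neg b)
      unneg²′ : ∀ a b → five * ((- b) * (- b)) ≤ (- a) * (- a) → five * (b * b) ≤ a * a
      unneg²′ a b = subst₂ (λ u v → five * u ≤ v) (neg*neg b) (neg*neg a)
      p²≡5q² : p * p ≡ five * (q * q)
      p²≡5q² with NonNeg⇒byDominant p q x≥0 | NonNeg⇒byDominant (- p) (- q) -x≥0
      ... | inj₁ (_ , 5q²≤p²) | inj₂ (_ , p²≤5q²) = ℚP.≤-antisym (unneg² p q p²≤5q²) 5q²≤p²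
      ... | inj₂ (_ , p²≤5q²) | inj₁ (_ , 5q²≤p²) = ℚP.≤-antisym p²≤5q² (unneg²′ p q 5q²≤p²)
      ... | inj₁ (0≤p , 5q²≤p²) | inj₁ (0≤-p , _) = sym (ℚP.≤-antisym 5q²≤p²
              (subst (λ z → z * z ≤ five * (q * q)) (sym (ℚP.≤-antisym (0≤-⇒≤0 0≤-p) 0≤p)) (0≤five*square q)))
      ... | inj₂ (0≤q , p²≤5q²) | inj₂ (0≤-q , _) = ℚP.≤-antisym p²≤5q²
              (subst (λ z → five * (z * z) ≤ p * p) (sym (ℚP.≤-antisym (0≤-⇒≤0 0≤-q) 0≤q)) (square-nonNeg p))
      q≡0 : q ≡ 0ℚ
      q≡0 = square≡5*square⇒≡0ℚ p q p²≡5q²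
      p≡0 : p ≡ 0ℚ
      p≡0 = square≡5*square⇒≡0ℚ 0ℚ p (sym (cong (five *_) (trans p²≡5q² (cong (λ z → five * (z * z)) q≡0))))


module Order where

  open QuadraticFieldRing
  open PositiveCone
  open IntegerEmbedding
  open Q5-Solver using (solve; _:+_; _:-_; _:*_; :-_; con; _:=_)
  open import Relation.Binary.Structures using (IsPartialOrder)
  open import Relation.Binary.Bundles using (Poset)

  ≤ᵠ-reflexive : ∀ {x y} → x ≡ y → x ≤ᵠ y
  ≤ᵠ-reflexive {⟨ p , q ⟩} refl =
    inj₁ (ℚP.≤-reflexive (sym (ℚP.+-inverseʳ p)) , ℚP.≤-reflexive (sym (ℚP.+-inverseʳ q)))

  ≤ᵠ-trans : ∀ x y z → x ≤ᵠ y → y ≤ᵠ z → x ≤ᵠ z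
  ≤ᵠ-trans x y z x≤y y≤z =
    subst NonNeg (solve 3 (λ x y z → (z :- y) :+ (y :- x) := z :- x) refl x y z) (NonNeg-⊕ (z ⊖ y) (y ⊖ x) y≤z x≤y)

  ≤ᵠ-antisym : ∀ x y → x ≤ᵠ y → y ≤ᵠ x → x ≡ y
  ≤ᵠ-antisym x y x≤y y≤x = begin
    x                 ≡⟨ solve 2 (λ x y → x := y :- (y :- x)) refl x y ⟩
    y ⊖ (y ⊖ x)       ≡⟨ cong (y ⊖_) (NonNeg-antisym (y ⊖ x) x≤y (subst NonNeg (solve 2 (λ x y → x :- y := :- (y :- x)) refl x y) y≤x)) ⟩
    y ⊖ 0ᵠ            ≡⟨ solve 1 (λ y → y :- con 0ᵠ := y) refl y ⟩
    y                 ∎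
    where open ≡-Reasoning

  ≤ᵠ-isPartialOrder : IsPartialOrder _≡_ _≤ᵠ_
  ≤ᵠ-isPartialOrder = record
    { isPreorder = record
      { isEquivalence = isEquivalence
      ; reflexive = ≤ᵠ-reflexive
      ; trans = λ {x} {y} {z} → ≤ᵠ-trans x y z }
    ; antisym = λ {x} {y} → ≤ᵠ-antisym x y }

  ≤ᵠ-poset : Poset _ _ _
  ≤ᵠ-poset = record { isPartialOrder = ≤ᵠ-isPartialOrder }

  ≰ᵠ⇒≥ᵠ : ∀ x y → ¬ (x ≤ᵠ y) → y ≤ᵠ x
  ≰ᵠ⇒≥ᵠ x y x≰y = subst NonNeg (solve 2 (λ x y → :- (y :- x) := x :- y) refl x y) (NonNeg-total (y ⊖ x) x≰y)

  _≤ᵠ?_ : ∀ x y → Dec (x ≤ᵠ y)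
  x ≤ᵠ? y = NonNeg? (y ⊖ x)

  _<ᵠ?_ : ∀ x y → Dec (x <ᵠ y)
  x <ᵠ? y = (x ≤ᵠ? y) ×-dec ¬? (x ≟ᵠ y)

  ⊕-monoˡ-≤ᵠ : ∀ z x y → x ≤ᵠ y → (x ⊕ z) ≤ᵠ (y ⊕ z)
  ⊕-monoˡ-≤ᵠ z x y = subst NonNeg (solve 3 (λ x y z → y :- x := (y :+ z) :- (x :+ z)) refl x y z)

  ⊕-mono-≤ᵠ : ∀ x y u v → x ≤ᵠ y → u ≤ᵠ v → (x ⊕ u) ≤ᵠ (y ⊕ v)
  ⊕-mono-≤ᵠ x y u v x≤y u≤v =
    subst NonNeg (solve 4 (λ x y u v → (y :- x) :+ (v :- u) := (y :+ v) :- (x :+ u)) refl x y u v) (NonNeg-⊕ (y ⊖ x) (v ⊖ u) x≤y u≤v)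

  ⊕-cancelˡ-≤ᵠ : ∀ w x y → (w ⊕ x) ≤ᵠ (w ⊕ y) → x ≤ᵠ y
  ⊕-cancelˡ-≤ᵠ w x y = subst NonNeg (solve 3 (λ w x y → (w :+ y) :- (w :+ x) := y :- x) refl w x y)

  ⊗-monoˡ-≤ᵠ : ∀ c x y → NonNeg c → x ≤ᵠ y → (c ⊗ x) ≤ᵠ (c ⊗ y)
  ⊗-monoˡ-≤ᵠ c x y c≥0 x≤y =
    subst NonNeg (solve 3 (λ c x y → c :* (y :- x) := c :* y :- c :* x) refl c x y) (NonNeg-⊗ c (y ⊖ x) c≥0 x≤y)

  ι-cancel-≤ᵠ : ∀ m n → ι m ≤ᵠ ι n → m ℤ.≤ n
  ι-cancel-≤ᵠ m n (inj₁ (0≤n-m , _)) = /1-cancel-≤ (SqrtFiveComparison.0≤-⇒≤ 0≤n-m)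
  ι-cancel-≤ᵠ m n (inj₂ (inj₁ (_ , 0<0 , _))) = contradiction 0<0 (ℚP.<-irrefl refl)
  ι-cancel-≤ᵠ m n (inj₂ (inj₂ (_ , 0<0 , _))) = contradiction 0<0 (ℚP.<-irrefl refl)

  ι-cancel-<ᵠ : ∀ m n → ι m <ᵠ ι n → m ℤ.< n
  ι-cancel-<ᵠ m n (ιm≤ιn , ιm≢ιn) = ℤP.≤∧≢⇒< (ι-cancel-≤ᵠ m n ιm≤ιn) (λ m≡n → ιm≢ιn (cong ι m≡n))

  ⊕-monoˡ-<ᵠ : ∀ z x y → x <ᵠ y → (x ⊕ z) <ᵠ (y ⊕ z)
  ⊕-monoˡ-<ᵠ z x y (x≤y , x≢y) = ⊕-monoˡ-≤ᵠ z x y x≤y , λ x+z≡y+z → x≢y (begin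
    x                 ≡⟨ solve 2 (λ x z → x := (x :+ z) :- z) refl x z ⟩
    (x ⊕ z) ⊖ z       ≡⟨ cong (_⊖ z) x+z≡y+z ⟩
    (y ⊕ z) ⊖ z       ≡⟨ solve 2 (λ y z → (y :+ z) :- z := y) refl y z ⟩
    y                 ∎)
    where open ≡-Reasoning


module Floor where

  open QuadraticFieldRing
  open IntegerEmbedding
  open Order
  -- Its strict relation, ≤ᵠ together with ≢, is literally _<ᵠ_.
  open import Relation.Binary.Reasoning.PartialOrder ≤ᵠ-poset
  open Q5-Solver using (solve; _:+_; _:-_; _:=_)
  open ℤ-Solver.+-*-Solver using () renaming (solve to ℤ-solve; _:+_ to _:+ᶻ_; _:-_ to _:-ᶻ_; con to conᶻ; _:=_ to _:=ᶻ_)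

  <+1⇒≤ : ∀ {i j} → i ℤ.< j ℤ.+ + 1 → i ℤ.≤ j
  <+1⇒≤ {i} {j} i<j+1 =
    subst (i ℤ.≤_) (ℤ-solve 1 (λ j → conᶻ -[1+ 0 ] :+ᶻ (j :+ᶻ conᶻ (+ 1)) :=ᶻ j) refl j) (ℤP.i<j⇒i≤pred[j] i<j+1)

  ℤ-range : ∀ l n {m} → l ℤ.≤ m → m ℤ.< l ℤ.+ + n → ∃ λ i → i ℕ.< n × m ≡ l ℤ.+ + i
  ℤ-range l n {m} l≤m m<l+n = ℤ.∣ m ℤ.- l ∣ , ℤP.drop‿+<+ i<n , m≡l+i
    where
      +i≡m-l : + ℤ.∣ m ℤ.- l ∣ ≡ m ℤ.- l
      +i≡m-l = ℤP.0≤i⇒+∣i∣≡i (ℤP.i≤j⇒0≤j-i l≤m)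
      m≡l+i : m ≡ l ℤ.+ + ℤ.∣ m ℤ.- l ∣
      m≡l+i = trans (ℤ-solve 2 (λ m l → m :=ᶻ l :+ᶻ (m :-ᶻ l)) refl m l) (cong (λ i → l ℤ.+ i) (sym +i≡m-l))
      i<n : + ℤ.∣ m ℤ.- l ∣ ℤ.< + n
      i<n = subst₂ ℤ._<_ (sym +i≡m-l) (ℤ-solve 2 (λ l n → (l :+ᶻ n) :-ᶻ l :=ᶻ n) refl l (+ n)) (ℤP.+-monoˡ-< (ℤ.- l) m<l+n)

  floor-lower : ∀ x m l → IsFloor x m → ι l ≤ᵠ x → l ℤ.≤ m
  floor-lower x m l (_ , x<m+1) ιl≤x = <+1⇒≤ (ι-cancel-<ᵠ l (m ℤ.+ + 1) (begin-strict
    ι l              ≤⟨ ιl≤x ⟩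
    x                <⟨ x<m+1 ⟩
    ι (m ℤ.+ + 1)    ∎))

  floor-upper : ∀ x m u → IsFloor x m → x <ᵠ ι u → m ℤ.< u
  floor-upper x m u (ιm≤x , _) x<ιu = ι-cancel-<ᵠ m u (begin-strict
    ι m              ≤⟨ ιm≤x ⟩
    x                <⟨ x<ιu ⟩
    ι u              ∎)

  IsFloor-unique : ∀ x m n → IsFloor x m → IsFloor x n → m ≡ n
  IsFloor-unique x m n x≥m@(ιm≤x , _) x≥n@(ιn≤x , _) = ℤP.≤-antisym (floor-lower x n m x≥n ιm≤x) (floor-lower x m n x≥m ιn≤x)

  ι-translate : ∀ z m → ι z ⊕ ι (m ℤ.- z) ≡ ι m
  ι-translate z m = trans (cong (ι z ⊕_) (ι-- m z)) (solve 2 (λ z m → z :+ (m :- z) := m) refl (ι z) (ι m))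

  IsFloor-translate : ∀ z y m → IsFloor (ι z ⊕ y) m → IsFloor y (m ℤ.- z)
  IsFloor-translate z y m (ιm≤z+y , z+y≤ιm+1 , z+y≢ιm+1) =
    ⊕-cancelˡ-≤ᵠ (ι z) (ι (m ℤ.- z)) y (subst (_≤ᵠ (ι z ⊕ y)) (sym (ι-translate z m)) ιm≤z+y) ,
    ⊕-cancelˡ-≤ᵠ (ι z) y (ι (m ℤ.- z ℤ.+ + 1)) (subst ((ι z ⊕ y) ≤ᵠ_) (sym z+ιm-z+1) z+y≤ιm+1) ,
    λ y≡ → z+y≢ιm+1 (trans (cong (ι z ⊕_) y≡) z+ιm-z+1)
    where
      z+ιm-z+1 : ι z ⊕ ι (m ℤ.- z ℤ.+ + 1) ≡ ι (m ℤ.+ + 1)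
      z+ιm-z+1 = trans (cong (λ i → ι z ⊕ ι i) (ℤ-solve 2 (λ m z → m :-ᶻ z :+ᶻ conᶻ (+ 1) :=ᶻ (m :+ᶻ conᶻ (+ 1)) :-ᶻ z) refl m z))
                       (ι-translate z (m ℤ.+ + 1))

  frac-translate : ∀ z y m → (ι z ⊕ y) ⊖ ι m ≡ y ⊖ ι (m ℤ.- z)
  frac-translate z y m = trans (cong ((ι z ⊕ y) ⊖_) (sym (ι-translate z m)))
    (solve 3 (λ z y w → (z :+ y) :- (z :+ w) := y :- w) refl (ι z) y (ι (m ℤ.- z)))

  IsFloor-between : ∀ l x → ι l ≤ᵠ x → x ≤ᵠ ι (l ℤ.+ + 2) → (∀ m → x ≢ ι m) → IsFloor x l ⊎ IsFloor x (l ℤ.+ + 1)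
  IsFloor-between l x ιl≤x x≤ιl+2 x≢ι with ι (l ℤ.+ + 1) ≤ᵠ? x
  ... | yes ιl+1≤x = inj₂ (ιl+1≤x , subst (λ i → x ≤ᵠ ι i) l+2≡l+1+1 x≤ιl+2 , x≢ι (l ℤ.+ + 1 ℤ.+ + 1))
    where l+2≡l+1+1 = ℤ-solve 1 (λ l → l :+ᶻ conᶻ (+ 2) :=ᶻ (l :+ᶻ conᶻ (+ 1)) :+ᶻ conᶻ (+ 1)) refl l
  ... | no ιl+1≰x = inj₁ (ιl≤x , ≰ᵠ⇒≥ᵠ (ι (l ℤ.+ + 1)) x ιl+1≰x , x≢ι (l ℤ.+ + 1))

  floor-range : ∀ x m l h → IsFloor x m → ι l ≤ᵠ x → x <ᵠ ι h → l ℤ.≤ m × m ℤ.< h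
  floor-range x m l h x≥m ιl≤x x<ιh = floor-lower x m l x≥m ιl≤x , floor-upper x m h x≥m x<ιh

  IsFloor-⊖-bounds : ∀ u e m → IsFloor (u ⊖ e) m → (ι m ⊕ e) ≤ᵠ u × u ≤ᵠ (ι (m ℤ.+ + 1) ⊕ e)
  IsFloor-⊖-bounds u e m (ιm≤u-e , u-e≤ιm+1 , _) =
    subst ((ι m ⊕ e) ≤ᵠ_) u-e+e≡u (⊕-monoˡ-≤ᵠ e (ι m) (u ⊖ e) ιm≤u-e) ,
    subst (_≤ᵠ (ι (m ℤ.+ + 1) ⊕ e)) u-e+e≡u (⊕-monoˡ-≤ᵠ e (u ⊖ e) (ι (m ℤ.+ + 1)) u-e≤ιm+1)
    where
      u-e+e≡u : (u ⊖ e) ⊕ e ≡ u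
      u-e+e≡u = solve 2 (λ u e → (u :- e) :+ e := u) refl u e



module GoldenRatio where

  open QuadraticFieldRing
  open IntegerEmbedding
  open PositiveCone using (NonNeg?)
  open Order
  open Floor

  -- The √5-coordinate of n φ is n / 2.
  ι⊗φ≢ι : ∀ n → n ≢ + 0 → ∀ m → ι n ⊗ φ ≢ ι m
  ι⊗φ≢ι n n≢0 m nφ≡m = n≢0 (ι-injective (⟨⟩-cong n≡0 refl))
    where
      open ℚ-Solver.+-*-Solver
      n≡0 : n / 1 ≡ 0ℚ
      n≡0 = trans (solve 1 (λ x → x := con (+ 2 / 1) :* (x :* con (+ 1 / 2) :+ con 0ℚ :* con (+ 1 / 2))) refl (n / 1))
                  (cong ((+ 2 / 1) ℚ.*_) (cong Q5.ir nφ≡m))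

  1≤φ : ι (+ 1) ≤ᵠ φ
  1≤φ = from-yes (NonNeg? (φ ⊖ ι (+ 1)))

  φ≤2 : φ ≤ᵠ ι (+ 2)
  φ≤2 = from-yes (NonNeg? (ι (+ 2) ⊖ φ))

  ι-suc⊗φ : ∀ i → ι (+ suc i) ⊗ φ ≡ ι (+ i) ⊗ φ ⊕ φ
  ι-suc⊗φ i = trans (cong (λ z → z ⊗ φ) (ι-+ (+ 1) (+ i)))
    (solve 1 (λ x → (con (ι (+ 1)) :+ x) :* con φ := x :* con φ :+ con φ) refl (ι (+ i)))
    where open Q5-Solver

  ι+1≤suc⊗φ : ∀ i m → ι m ≤ᵠ (ι (+ i) ⊗ φ) → ι (m ℤ.+ + 1) ≤ᵠ (ι (+ suc i) ⊗ φ)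
  ι+1≤suc⊗φ i m ιm≤iφ =
    subst₂ _≤ᵠ_ (sym (ι-+ m (+ 1))) (sym (ι-suc⊗φ i)) (⊕-mono-≤ᵠ (ι m) (ι (+ i) ⊗ φ) (ι (+ 1)) φ ιm≤iφ 1≤φ)

  floor-suc⊗φ : ∀ i m → IsFloor (ι (+ i) ⊗ φ) m →
                IsFloor (ι (+ suc i) ⊗ φ) (m ℤ.+ + 1) ⊎ IsFloor (ι (+ suc i) ⊗ φ) (m ℤ.+ + 1 ℤ.+ + 1)
  floor-suc⊗φ i m (ιm≤iφ , iφ≤ιm+1 , _) =
    IsFloor-between (m ℤ.+ + 1) (ι (+ suc i) ⊗ φ) (ι+1≤suc⊗φ i m ιm≤iφ) upper (ι⊗φ≢ι (+ suc i) (λ ()))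
    where
      upper : (ι (+ suc i) ⊗ φ) ≤ᵠ ι (m ℤ.+ + 1 ℤ.+ + 2)
      upper = subst₂ _≤ᵠ_ (sym (ι-suc⊗φ i)) (sym (ι-+ (m ℤ.+ + 1) (+ 2)))
                (⊕-mono-≤ᵠ (ι (+ i) ⊗ φ) (ι (m ℤ.+ + 1)) φ (ι (+ 2)) iφ≤ιm+1 φ≤2)

  IsFloor-0⊗φ : IsFloor (ι (+ 0) ⊗ φ) (+ 0)
  IsFloor-0⊗φ = from-yes (NonNeg? (ι (+ 0) ⊗ φ ⊖ ι (+ 0))) , from-yes (NonNeg? (ι (+ 1) ⊖ ι (+ 0) ⊗ φ)) , from-no ((ι (+ 0) ⊗ φ) ≟ᵠ ι (+ 1))

  floor⊗φ : ∀ i → Σ ℤ (IsFloor (ι (+ i) ⊗ φ))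
  floor⊗φ zero = + 0 , IsFloor-0⊗φ
  floor⊗φ (suc i) = [ m ℤ.+ + 1 ,_ , m ℤ.+ + 1 ℤ.+ + 1 ,_ ]′ (floor-suc⊗φ i m (proj₂ (floor⊗φ i)))
    where m = proj₁ (floor⊗φ i)

  -- Opaque, so that the type checker never unfolds the recursion of floor⊗φ.
  opaque
    ⌊_φ⌋ : ℕ → ℤ
    ⌊ i φ⌋ = proj₁ (floor⊗φ i)

    ⌊φ⌋-IsFloor : ∀ i → IsFloor (ι (+ i) ⊗ φ) ⌊ i φ⌋
    ⌊φ⌋-IsFloor i = proj₂ (floor⊗φ i)

  ⌊φ⌋-suc : ∀ i → ⌊ i φ⌋ ℤ.+ + 1 ℤ.≤ ⌊ suc i φ⌋
  ⌊φ⌋-suc i = floor-lower (ι (+ suc i) ⊗ φ) ⌊ suc i φ⌋ (⌊ i φ⌋ ℤ.+ + 1) (⌊φ⌋-IsFloor (suc i))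
                (ι+1≤suc⊗φ i ⌊ i φ⌋ (proj₁ (⌊φ⌋-IsFloor i)))


module SetS where

  open Floor using (IsFloor-unique)
  open GoldenRatio
  open import Data.List using (List; []; _∷_; length)
  open import Data.List.Membership.Propositional using (_∈_)
  open import Data.List.Relation.Unary.Any using (here; there)
  import Data.List.Relation.Unary.All as All
  open import Data.List.Relation.Unary.AllPairs using (_∷_; [])
  open import Data.List.Relation.Unary.Unique.Propositional using (Unique)
  open import Data.List.Membership.Propositional.Properties.WithK using (unique∧set⇒bag)
  open import Data.List.Relation.Binary.BagAndSetEquality using (∼bag⇒↭)
  open import Data.List.Relation.Binary.Permutation.Propositional.Properties using (↭-length)
  open import Function.Bundles using (_⇔_; mk⇔)
  import Function.Properties.Equivalence as ⇔
  open ℤ-Solver.+-*-Solver using (solve; _:+_; _:-_; _:*_; con; _:=_)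

  unique-length : ∀ {xs ys : List ℤ} → Unique xs → Unique ys → (∀ {x} → x ∈ xs ⇔ x ∈ ys) → length xs ≡ length ys
  unique-length xs! ys! xs⇔ys = ↭-length (∼bag⇒↭ (unique∧set⇒bag xs! ys! xs⇔ys))

  c : ℕ → ℤ
  c s = cOf (+ s) ⌊ s φ⌋

  _≡_±1 : ℤ → ℤ → Set
  x ≡ y ±1 = x ≡ y ℤ.- + 1 ⊎ x ≡ y ℤ.+ + 1

  c-suc : ∀ s → c s ℤ.+ + 3 ℤ.≤ c (suc s)
  c-suc s = subst₂ ℤ._≤_
    (solve 2 (λ a x → (a :+ con (+ 1)) :+ (con (+ 2) :* x :+ con (+ 1)) := (a :+ con (+ 2) :* x :- con (+ 1)) :+ con (+ 3)) refl ⌊ s φ⌋ (+ s))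
    (solve 2 (λ b x → b :+ (con (+ 2) :* x :+ con (+ 1)) := b :+ con (+ 2) :* (con (+ 1) :+ x) :- con (+ 1)) refl ⌊ suc s φ⌋ (+ s))
    (ℤP.+-monoˡ-≤ (+ 2 ℤ.* + s ℤ.+ + 1) (⌊φ⌋-suc s))

  c-mono-< : ∀ {s t} → s ℕ.< t → c s ℤ.+ + 3 ℤ.≤ c t
  c-mono-< {s} {suc t} (s≤s s≤t) with ℕP.m≤n⇒m<n∨m≡n s≤t
  ... | inj₂ refl = c-suc s
  ... | inj₁ s<t = ℤP.≤-trans (c-mono-< s<t) (ℤP.≤-trans (ℤP.i≤i+j (c t) (+ 3)) (c-suc t))

  c-mono-≤ : ∀ {s t} → s ℕ.≤ t → c s ℤ.≤ c t
  c-mono-≤ {s} {t} s≤t with ℕP.m≤n⇒m<n∨m≡n s≤t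
  ... | inj₂ refl = ℤP.≤-refl
  ... | inj₁ s<t = ℤP.≤-trans (ℤP.i≤i+j (c s) (+ 3)) (c-mono-< s<t)

  InS⇒c±1 : ∀ {x} → InS x → ∃ λ s → 1 ℕ.≤ s × x ≡ c s ±1
  InS⇒c±1 (+ zero , _ , ℤ.+≤+ () , _)
  InS⇒c±1 {x} (+ suc t , a , _ , a-IsFloor , x≡) =
    suc t , s≤s z≤n , subst (λ a → x ≡ cOf (+ suc t) a ±1) (IsFloor-unique (ι (+ suc t) ⊗ φ) a ⌊ suc t φ⌋ a-IsFloor (⌊φ⌋-IsFloor (suc t))) x≡

  c±1⇒InS : ∀ {x} s → 1 ℕ.≤ s → x ≡ c s ±1 → InS x
  c±1⇒InS (suc t) _ x≡ = + suc t , ⌊ suc t φ⌋ , ℤ.+≤+ (s≤s z≤n) , ⌊φ⌋-IsFloor (suc t) , x≡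

  S-upTo : ℕ → List ℤ
  S-upTo zero = []
  S-upTo (suc s) = (c (suc s) ℤ.+ + 1) ∷ (c (suc s) ℤ.- + 1) ∷ S-upTo s

  length-S-upTo : ∀ s → length (S-upTo s) ≡ s ℕ.+ s
  length-S-upTo zero = refl
  length-S-upTo (suc s) = cong suc (trans (cong suc (length-S-upTo s)) (sym (ℕP.+-suc s s)))

  InS-upTo : ℕ → ℤ → Set
  InS-upTo s x = ∃ λ t → 1 ℕ.≤ t × t ℕ.≤ s × x ≡ c t ±1

  ∈S-upTo⇒ : ∀ s {x} → x ∈ S-upTo s → InS-upTo s x
  ∈S-upTo⇒ (suc s) (here refl) = suc s , s≤s z≤n , ℕP.≤-refl , inj₂ refl
  ∈S-upTo⇒ (suc s) (there (here refl)) = suc s , s≤s z≤n , ℕP.≤-refl , inj₁ refl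
  ∈S-upTo⇒ (suc s) (there (there x∈)) with ∈S-upTo⇒ s x∈
  ... | t , 1≤t , t≤s , x≡ = t , 1≤t , ℕP.m≤n⇒m≤1+n t≤s , x≡

  ⇒∈S-upTo : ∀ s {x} → InS-upTo s x → x ∈ S-upTo s
  ⇒∈S-upTo zero (t , 1≤t , t≤0 , _) = contradiction (ℕP.≤-trans 1≤t t≤0) λ ()
  ⇒∈S-upTo (suc s) (t , 1≤t , t≤s+1 , x≡) with ℕP.m≤n⇒m<n∨m≡n t≤s+1
  ⇒∈S-upTo (suc s) (t , _ , _ , inj₁ refl) | inj₂ refl = there (here refl)
  ⇒∈S-upTo (suc s) (t , _ , _ , inj₂ refl) | inj₂ refl = here refl
  ... | inj₁ (s≤s t≤s) = there (there (⇒∈S-upTo s (t , 1≤t , t≤s , x≡)))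

  c-1<c+1 : ∀ y → y ℤ.- + 1 ℤ.< y ℤ.+ + 1
  c-1<c+1 y = subst₂ ℤ._<_ (solve 1 (λ y → y :+ con -[1+ 0 ] := y :- con (+ 1)) refl y) refl
                (ℤP.+-monoʳ-< y (ℤ.-<+ {0} {1}))

  -- c grows by at least 3 at each step, so c s + 1 < c (s+1) - 1.
  InS-upTo⇒+2≤ : ∀ {s x} → InS-upTo s x → x ℤ.+ + 2 ℤ.≤ c (suc s)
  InS-upTo⇒+2≤ {s} {x} (t , _ , t≤s , x≡) = ℤP.≤-trans (+2≤c+3 x≡) (c-mono-< (s≤s t≤s))
    where
      +2≤c+3 : x ≡ c t ±1 → x ℤ.+ + 2 ℤ.≤ c t ℤ.+ + 3
      +2≤c+3 (inj₁ refl) = ℤP.≤-trans (ℤP.≤-reflexive (solve 1 (λ y → (y :- con (+ 1)) :+ con (+ 2) := y :+ con (+ 1)) refl (c t)))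
                                       (ℤP.+-monoʳ-≤ (c t) (ℤ.+≤+ (s≤s z≤n)))
      +2≤c+3 (inj₂ refl) = ℤP.≤-reflexive (solve 1 (λ y → (y :+ con (+ 1)) :+ con (+ 2) := y :+ con (+ 3)) refl (c t))

  +2≤⇒<-1 : ∀ {x y} → x ℤ.+ + 2 ℤ.≤ y → x ℤ.< y ℤ.- + 1
  +2≤⇒<-1 {x} {y} x+2≤y = ℤP.suc[i]≤j⇒i<j (subst₂ ℤ._≤_
    (solve 1 (λ x → (x :+ con (+ 2)) :- con (+ 1) := con (+ 1) :+ x) refl x) refl (ℤP.+-monoˡ-≤ (ℤ.- + 1) x+2≤y))

  c-1∉S-upTo : ∀ s {x} → x ∈ S-upTo s → c (suc s) ℤ.- + 1 ≢ x
  c-1∉S-upTo s x∈ c-1≡x = ℤP.<⇒≢ (+2≤⇒<-1 (InS-upTo⇒+2≤ (∈S-upTo⇒ s x∈))) (sym c-1≡x)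

  S-upTo-unique : ∀ s → Unique (S-upTo s)
  S-upTo-unique zero = []
  S-upTo-unique (suc s) = All.tabulate c+1∉ ∷ All.tabulate (c-1∉S-upTo s) ∷ S-upTo-unique s
    where
      c+1∉ : ∀ {x} → x ∈ (c (suc s) ℤ.- + 1) ∷ S-upTo s → c (suc s) ℤ.+ + 1 ≢ x
      c+1∉ (here refl) c+1≡c-1 = ℤP.<⇒≢ (c-1<c+1 (c (suc s))) (sym c+1≡c-1)
      c+1∉ (there x∈) c+1≡x = ℤP.<⇒≢ (ℤP.<-trans (+2≤⇒<-1 (InS-upTo⇒+2≤ (∈S-upTo⇒ s x∈))) (c-1<c+1 (c (suc s)))) (sym c+1≡x)

  ±1-lower : ∀ {x} y → x ≡ y ±1 → y ℤ.- + 1 ℤ.≤ x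
  ±1-lower y (inj₁ refl) = ℤP.≤-refl
  ±1-lower y (inj₂ refl) = ℤP.<⇒≤ (c-1<c+1 y)

  InS-upTo⇒InS : ∀ {s x} → InS-upTo s x → InS x
  InS-upTo⇒InS (t , 1≤t , _ , x≡) = c±1⇒InS t 1≤t x≡

  InS-below-c-1 : ∀ t x → (InS x × x ℤ.< c (suc t) ℤ.- + 1) ⇔ x ∈ S-upTo t
  InS-below-c-1 t x = mk⇔ to from
    where
      to : InS x × x ℤ.< c (suc t) ℤ.- + 1 → x ∈ S-upTo t
      to (x∈S , x<) with InS⇒c±1 x∈S
      ... | s , 1≤s , x≡ with s ℕ.≤? t
      ...   | yes s≤t = ⇒∈S-upTo t (s , 1≤s , s≤t , x≡)
      ...   | no s≰t = contradiction x< (ℤP.≤⇒≯ (ℤP.≤-trans (ℤP.+-monoˡ-≤ (ℤ.- + 1) (c-mono-≤ (ℕP.≰⇒> s≰t))) (±1-lower (c s) x≡)))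
      from : x ∈ S-upTo t → InS x × x ℤ.< c (suc t) ℤ.- + 1
      from x∈ = InS-upTo⇒InS (∈S-upTo⇒ t x∈) , +2≤⇒<-1 (InS-upTo⇒+2≤ (∈S-upTo⇒ t x∈))

  InS-below-c+1 : ∀ t x → (InS x × x ℤ.< c (suc t) ℤ.+ + 1) ⇔ x ∈ (c (suc t) ℤ.- + 1) ∷ S-upTo t
  InS-below-c+1 t x = mk⇔ to from
    where
      to : InS x × x ℤ.< c (suc t) ℤ.+ + 1 → x ∈ (c (suc t) ℤ.- + 1) ∷ S-upTo t
      to (x∈S , x<) with InS⇒c±1 x∈S
      ... | s , 1≤s , x≡ with s ℕ.≤? t
      ...   | yes s≤t = there (⇒∈S-upTo t (s , 1≤s , s≤t , x≡))
      ...   | no s≰t with ℕP.m≤n⇒m<n∨m≡n (ℕP.≰⇒> s≰t)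
      ...     | inj₂ refl = [ here , (λ x≡c+1 → contradiction x≡c+1 (ℤP.<⇒≢ x<)) ]′ x≡
      ...     | inj₁ t+1<s = contradiction x< (ℤP.≤⇒≯ (ℤP.≤-trans c+1≤c-1 (±1-lower (c s) x≡)))
        where
          c+1≤c-1 : c (suc t) ℤ.+ + 1 ℤ.≤ c s ℤ.- + 1
          c+1≤c-1 = ℤP.≤-trans (ℤP.i≤i+j (c (suc t) ℤ.+ + 1) (+ 1))
            (subst₂ ℤ._≤_ (solve 1 (λ y → (y :+ con (+ 3)) :- con (+ 1) := y :+ con (+ 1) :+ con (+ 1)) refl (c (suc t))) refl
              (ℤP.+-monoˡ-≤ (ℤ.- + 1) (c-mono-< t+1<s)))
      from : x ∈ (c (suc t) ℤ.- + 1) ∷ S-upTo t → InS x × x ℤ.< c (suc t) ℤ.+ + 1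
      from (here refl) = c±1⇒InS (suc t) (s≤s z≤n) (inj₁ refl) , c-1<c+1 (c (suc t))
      from (there x∈) = InS-upTo⇒InS (∈S-upTo⇒ t x∈) ,
                        ℤP.<-trans (+2≤⇒<-1 (InS-upTo⇒+2≤ (∈S-upTo⇒ t x∈))) (c-1<c+1 (c (suc t)))

  rank-c-1 : ∀ {k} t → KthSmallestS k (c (suc t) ℤ.- + 1) → k ≡ suc (t ℕ.+ t)
  rank-c-1 {k} t (_ , L , L! , |L|+1≡k , L⇔) = begin
    k                              ≡⟨ sym |L|+1≡k ⟩
    length L ℕ.+ 1                 ≡⟨ cong (ℕ._+ 1) (unique-length L! (S-upTo-unique t) (λ {x} → ⇔.trans (L⇔ x) (InS-below-c-1 t x))) ⟩
    length (S-upTo t) ℕ.+ 1        ≡⟨ cong (ℕ._+ 1) (length-S-upTo t) ⟩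
    t ℕ.+ t ℕ.+ 1                  ≡⟨ ℕP.+-comm (t ℕ.+ t) 1 ⟩
    suc (t ℕ.+ t)                  ∎
    where open ≡-Reasoning

  rank-c+1 : ∀ {k} t → KthSmallestS k (c (suc t) ℤ.+ + 1) → k ≡ suc (suc (t ℕ.+ t))
  rank-c+1 {k} t (_ , L , L! , |L|+1≡k , L⇔) = begin
    k                              ≡⟨ sym |L|+1≡k ⟩
    length L ℕ.+ 1                 ≡⟨ cong (ℕ._+ 1) (unique-length L! (All.tabulate (c-1∉S-upTo t) ∷ S-upTo-unique t) (λ {x} → ⇔.trans (L⇔ x) (InS-below-c+1 t x))) ⟩
    suc (length (S-upTo t)) ℕ.+ 1  ≡⟨ cong (λ l → suc l ℕ.+ 1) (length-S-upTo t) ⟩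
    suc (t ℕ.+ t) ℕ.+ 1            ≡⟨ ℕP.+-comm (suc (t ℕ.+ t)) 1 ⟩
    suc (suc (t ℕ.+ t))            ∎
    where open ≡-Reasoning


module FractionalParts where

  open QuadraticFieldRing
  open PositiveCone using (NonNeg?)
  open Order
  open Floor
  open import Relation.Binary.Reasoning.PartialOrder ≤ᵠ-poset
  open Q5-Solver using (solve; _:+_; _:-_; _:*_; _:=_; con)

  -- The b of the theorem, for x with floor m and y with floor n: {y} - coef {x}.
  residual : Q5 → ℤ → Q5 → ℤ → Q5
  residual y n x m = (y ⊖ ι n) ⊖ coef ⊗ (x ⊖ ι m)

  coef≥0 : NonNeg coef
  coef≥0 = from-yes (NonNeg? coef)

  coef-floor-cases : ∀ u d n lo hi l k → IsFloor (coef ⊗ u ⊕ d) n → lo ≤ᵠ u → u ≤ᵠ hi →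
                     ι l ≤ᵠ (coef ⊗ lo ⊕ d) → (coef ⊗ hi ⊕ d) <ᵠ ι (l ℤ.+ + k) → ∃ λ i → i ℕ.< k × n ≡ l ℤ.+ + i
  coef-floor-cases u d n lo hi l k x≥n lo≤u u≤hi ιl≤ hi<ι =
    uncurry (ℤ-range l k) (floor-range (coef ⊗ u ⊕ d) n l (l ℤ.+ + k) x≥n lower upper)
    where
      lower : ι l ≤ᵠ (coef ⊗ u ⊕ d)
      lower = begin
        ι l              ≤⟨ ιl≤ ⟩
        coef ⊗ lo ⊕ d    ≤⟨ ⊕-monoˡ-≤ᵠ d (coef ⊗ lo) (coef ⊗ u) (⊗-monoˡ-≤ᵠ coef lo u coef≥0 lo≤u) ⟩
        coef ⊗ u ⊕ d     ∎
      upper : (coef ⊗ u ⊕ d) <ᵠ ι (l ℤ.+ + k)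
      upper = begin-strict
        coef ⊗ u ⊕ d     ≤⟨ ⊕-monoˡ-≤ᵠ d (coef ⊗ u) (coef ⊗ hi) (⊗-monoˡ-≤ᵠ coef u hi coef≥0 u≤hi) ⟩
        coef ⊗ hi ⊕ d    <⟨ hi<ι ⟩
        ι (l ℤ.+ + k)    ∎

  -- ⌊u⌋ = 0 forces ⌊coef·u⌋ = 0 as coef < 1, and ⌊u⌋ = 1 allows ⌊coef·u⌋ ∈ {0, 1} as 2 coef < 2.
  even-residual : ∀ u m n → ι (+ 0) ≤ᵠ u → u <ᵠ ι (+ 2) → IsFloor u m → IsFloor (coef ⊗ u) n →
                  EvenB (residual (coef ⊗ u) n u m)
  even-residual u m n 0≤u u<2 u≥m cu≥n =
    subst EvenB (solve 3 (λ u m n → con coef :* m :- n := (con coef :* u :- n) :- con coef :* (u :- m)) refl u (ι m) (ι n))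
      (by-m (uncurry (ℤ-range (+ 0) 2) (floor-range u m (+ 0) (+ 2) u≥m 0≤u u<2)))
    where
      b : ℤ → ℤ → Q5
      b m n = coef ⊗ ι m ⊖ ι n
      n-cases : ∀ hi k → u ≤ᵠ hi → (coef ⊗ hi ⊕ 0ᵠ) <ᵠ ι (+ 0 ℤ.+ + k) → ∃ λ i → i ℕ.< k × n ≡ + 0 ℤ.+ + i
      n-cases hi k u≤hi hi<ι = coef-floor-cases u 0ᵠ n (ι (+ 0)) hi (+ 0) k
        (subst (λ x → IsFloor x n) (solve 1 (λ x → x := x :+ con 0ᵠ) refl (coef ⊗ u)) cu≥n)
        0≤u u≤hi (from-yes (ι (+ 0) ≤ᵠ? (coef ⊗ ι (+ 0) ⊕ 0ᵠ))) hi<ι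
      m≡0-case : m ≡ + 0 → (∃ λ i → i ℕ.< 1 × n ≡ + 0 ℤ.+ + i) → EvenB (b m n)
      m≡0-case m≡0 (0 , _ , n≡0) = subst₂ (λ m n → EvenB (b m n)) (sym m≡0) (sym n≡0) (inj₁ refl)
      m≡0-case _ (suc _ , s≤s () , _)
      m≡1-case : m ≡ + 1 → (∃ λ i → i ℕ.< 2 × n ≡ + 0 ℤ.+ + i) → EvenB (b m n)
      m≡1-case m≡1 (0 , _ , n≡0) = subst₂ (λ m n → EvenB (b m n)) (sym m≡1) (sym n≡0) (inj₂ (inj₂ refl))
      m≡1-case m≡1 (1 , _ , n≡1) = subst₂ (λ m n → EvenB (b m n)) (sym m≡1) (sym n≡1) (inj₂ (inj₁ refl))
      m≡1-case _ (suc (suc _) , s≤s (s≤s ()) , _)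
      by-m : (∃ λ i → i ℕ.< 2 × m ≡ + 0 ℤ.+ + i) → EvenB (b m n)
      by-m (0 , _ , m≡0) = m≡0-case m≡0 (n-cases (ι (+ 1)) 1
        (subst (λ m → u ≤ᵠ ι (m ℤ.+ + 1)) m≡0 (proj₁ (proj₂ u≥m))) (from-yes ((coef ⊗ ι (+ 1) ⊕ 0ᵠ) <ᵠ? ι (+ 1))))
      by-m (1 , _ , m≡1) = m≡1-case m≡1 (n-cases (ι (+ 2)) 2 (proj₁ u<2) (from-yes ((coef ⊗ ι (+ 2) ⊕ 0ᵠ) <ᵠ? ι (+ 2))))
      by-m (suc (suc _) , s≤s (s≤s ()) , _)

  floor-⊖φ-cases : ∀ u m → ι (+ 0) ≤ᵠ u → u <ᵠ ι (+ 2) → IsFloor (u ⊖ φ) m → ∃ λ i → i ℕ.< 3 × m ≡ -[1+ 1 ] ℤ.+ + i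
  floor-⊖φ-cases u m 0≤u u<2 u-φ≥m = uncurry (ℤ-range -[1+ 1 ] 3) (floor-range (u ⊖ φ) m -[1+ 1 ] (+ 1) u-φ≥m lower upper)
    where
      lower : ι -[1+ 1 ] ≤ᵠ (u ⊖ φ)
      lower = begin
        ι -[1+ 1 ]       ≤⟨ from-yes (ι -[1+ 1 ] ≤ᵠ? (ι (+ 0) ⊖ φ)) ⟩
        ι (+ 0) ⊖ φ      ≤⟨ ⊕-monoˡ-≤ᵠ (⊝ φ) (ι (+ 0)) u 0≤u ⟩
        u ⊖ φ            ∎
      upper : (u ⊖ φ) <ᵠ ι (+ 1)
      upper = begin-strict
        u ⊖ φ            ≤⟨ ⊕-monoˡ-≤ᵠ (⊝ φ) u (ι (+ 2)) (proj₁ u<2) ⟩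
        ι (+ 2) ⊖ φ      <⟨ from-yes ((ι (+ 2) ⊖ φ) <ᵠ? ι (+ 1)) ⟩
        ι (+ 1)          ∎

  -- ⌊u - φ⌋ = -2, -1, 0 confines u to [0, φ - 1], [φ - 1, φ], [φ, 2], on which ⌊coef·u - 2φ⌋
  -- lies in {-4, -3}, {-3}, {-3, -2} respectively.
  odd-residual : ∀ u m n → ι (+ 0) ≤ᵠ u → u <ᵠ ι (+ 2) → IsFloor (u ⊖ φ) m → IsFloor (coef ⊗ u ⊖ ι (+ 2) ⊗ φ) n →
                 OddB (residual (coef ⊗ u ⊖ ι (+ 2) ⊗ φ) n (u ⊖ φ) m)
  odd-residual u m n 0≤u u<2 u-φ≥m x≥n =
    subst OddB (solve 3 (λ u m n → (con coef :* con φ :- con (ι (+ 2)) :* con φ) :+ (con coef :* m :- n)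
                               := ((con coef :* u :- con (ι (+ 2)) :* con φ) :- n) :- con coef :* ((u :- con φ) :- m))
                        refl u (ι m) (ι n))
      (by-m (floor-⊖φ-cases u m 0≤u u<2 u-φ≥m))
    where
      d : Q5
      d = ⊝ (ι (+ 2) ⊗ φ)
      b : ℤ → ℤ → Q5
      b m n = (coef ⊗ φ ⊖ ι (+ 2) ⊗ φ) ⊕ (coef ⊗ ι m ⊖ ι n)
      u-bounds : ∀ {m′} → m ≡ m′ → (ι m′ ⊕ φ) ≤ᵠ u × u ≤ᵠ (ι (m′ ℤ.+ + 1) ⊕ φ)
      u-bounds refl = IsFloor-⊖-bounds u φ m u-φ≥m
      n-cases : ∀ lo hi l k → lo ≤ᵠ u → u ≤ᵠ hi → ι l ≤ᵠ (coef ⊗ lo ⊕ d) → (coef ⊗ hi ⊕ d) <ᵠ ι (l ℤ.+ + k) →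
                ∃ λ i → i ℕ.< k × n ≡ l ℤ.+ + i
      n-cases lo hi l k = coef-floor-cases u d n lo hi l k x≥n
      m≡-2-case : m ≡ -[1+ 1 ] → (∃ λ i → i ℕ.< 2 × n ≡ -[1+ 3 ] ℤ.+ + i) → OddB (b m n)
      m≡-2-case m≡ (0 , _ , n≡) = subst₂ (λ m n → OddB (b m n)) (sym m≡) (sym n≡) (inj₂ (inj₁ refl))
      m≡-2-case m≡ (1 , _ , n≡) = subst₂ (λ m n → OddB (b m n)) (sym m≡) (sym n≡) (inj₁ refl)
      m≡-2-case _ (suc (suc _) , s≤s (s≤s ()) , _)
      m≡-1-case : m ≡ -[1+ 0 ] → (∃ λ i → i ℕ.< 1 × n ≡ -[1+ 2 ] ℤ.+ + i) → OddB (b m n)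
      m≡-1-case m≡ (0 , _ , n≡) = subst₂ (λ m n → OddB (b m n)) (sym m≡) (sym n≡) (inj₂ (inj₂ (inj₁ refl)))
      m≡-1-case _ (suc _ , s≤s () , _)
      m≡0-case : m ≡ + 0 → (∃ λ i → i ℕ.< 2 × n ≡ -[1+ 2 ] ℤ.+ + i) → OddB (b m n)
      m≡0-case m≡ (0 , _ , n≡) = subst₂ (λ m n → OddB (b m n)) (sym m≡) (sym n≡) (inj₂ (inj₂ (inj₂ (inj₂ refl))))
      m≡0-case m≡ (1 , _ , n≡) = subst₂ (λ m n → OddB (b m n)) (sym m≡) (sym n≡) (inj₂ (inj₂ (inj₂ (inj₁ refl))))
      m≡0-case _ (suc (suc _) , s≤s (s≤s ()) , _)
      by-m : (∃ λ i → i ℕ.< 3 × m ≡ -[1+ 1 ] ℤ.+ + i) → OddB (b m n)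
      by-m (0 , _ , m≡) = m≡-2-case m≡ (n-cases (ι (+ 0)) (ι -[1+ 0 ] ⊕ φ) -[1+ 3 ] 2 0≤u (proj₂ (u-bounds m≡))
        (from-yes (ι -[1+ 3 ] ≤ᵠ? (coef ⊗ ι (+ 0) ⊕ d))) (from-yes ((coef ⊗ (ι -[1+ 0 ] ⊕ φ) ⊕ d) <ᵠ? ι -[1+ 1 ])))
      by-m (1 , _ , m≡) = m≡-1-case m≡ (n-cases (ι -[1+ 0 ] ⊕ φ) (ι (+ 0) ⊕ φ) -[1+ 2 ] 1 (proj₁ (u-bounds m≡)) (proj₂ (u-bounds m≡))
        (from-yes (ι -[1+ 2 ] ≤ᵠ? (coef ⊗ (ι -[1+ 0 ] ⊕ φ) ⊕ d))) (from-yes ((coef ⊗ (ι (+ 0) ⊕ φ) ⊕ d) <ᵠ? ι -[1+ 1 ])))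
      by-m (2 , _ , m≡) = m≡0-case m≡ (n-cases (ι (+ 0) ⊕ φ) (ι (+ 2)) -[1+ 2 ] 2 (proj₁ (u-bounds m≡)) (proj₁ u<2)
        (from-yes (ι -[1+ 2 ] ≤ᵠ? (coef ⊗ (ι (+ 0) ⊕ φ) ⊕ d))) (from-yes ((coef ⊗ ι (+ 2) ⊕ d) <ᵠ? ι -[1+ 0 ])))
      by-m (suc (suc (suc _)) , s≤s (s≤s (s≤s ())) , _)

  residual-spec : ∀ y n x m → y ⊖ ι n ≡ coef ⊗ (x ⊖ ι m) ⊕ residual y n x m
  residual-spec y n x m = solve 2 (λ a c → a := c :+ (a :- c)) refl (y ⊖ ι n) (coef ⊗ (x ⊖ ι m))


module Decomposition where

  open QuadraticFieldRing
  open IntegerEmbedding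
  open Order
  open Floor
  open FractionalParts
  open import Relation.Binary.Reasoning.PartialOrder ≤ᵠ-poset
  open Q5-Solver using (solve; _:+_; _:-_; _:*_; _:=_; con)

  double-frac : Q5 → ℤ → Q5
  double-frac x m = (x ⊖ ι m) ⊕ (x ⊖ ι m)

  double-frac-bounds : ∀ x m → IsFloor x m → ι (+ 0) ≤ᵠ double-frac x m × double-frac x m <ᵠ ι (+ 2)
  double-frac-bounds x m x≥m = lower , upper
    where
      f = x ⊖ ι m
      f≥0 : IsFloor f (+ 0)
      f≥0 = subst (IsFloor f) (ℤP.+-inverseʳ m)
              (IsFloor-translate m f m (subst (λ y → IsFloor y m) (solve 2 (λ x m → x := m :+ (x :- m)) refl x (ι m)) x≥m))
      lower : ι (+ 0) ≤ᵠ (f ⊕ f)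
      lower = begin
        ι (+ 0)           ≡⟨ solve 0 (con (ι (+ 0)) := con (ι (+ 0)) :+ con (ι (+ 0))) refl ⟩
        ι (+ 0) ⊕ ι (+ 0) ≤⟨ ⊕-mono-≤ᵠ (ι (+ 0)) f (ι (+ 0)) f (proj₁ f≥0) (proj₁ f≥0) ⟩
        f ⊕ f             ∎
      upper : (f ⊕ f) <ᵠ ι (+ 2)
      upper = begin-strict
        f ⊕ f             ≤⟨ ⊕-mono-≤ᵠ f f f (ι (+ 1)) (≤ᵠ-reflexive {f} refl) (proj₁ (proj₂ f≥0)) ⟩
        f ⊕ ι (+ 1)       <⟨ ⊕-monoˡ-<ᵠ (ι (+ 1)) f (ι (+ 1)) (proj₂ f≥0) ⟩
        ι (+ 1) ⊕ ι (+ 1) ≡⟨ sym (ι-+ (+ 1) (+ 1)) ⟩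
        ι (+ 2)           ∎

  residual-translate : ∀ z y n w x m → residual (ι z ⊕ y) n (ι w ⊕ x) m ≡ residual y (n ℤ.- z) x (m ℤ.- w)
  residual-translate z y n w x m = cong₂ (λ a b → a ⊖ coef ⊗ b) (frac-translate z y n) (frac-translate w x m)

  ι-2* : ∀ j → ι (+ 2 ℤ.* j) ≡ ι (+ 2) ⊗ ι j
  ι-2* = ι-* (+ 2)

  ι-3*+ : ∀ A j → ι (+ 3 ℤ.* A ℤ.+ j) ≡ ι (+ 3) ⊗ ι A ⊕ ι j
  ι-3*+ A j = trans (ι-+ (+ 3 ℤ.* A) j) (cong (_⊕ ι j) (ι-* (+ 3) A))

  ι-+2* : ∀ A j → ι (A ℤ.+ + 2 ℤ.* j) ≡ ι A ⊕ ι (+ 2) ⊗ ι j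
  ι-+2* A j = trans (ι-+ A (+ 2 ℤ.* j)) (cong (ι A ⊕_) (ι-2* j))

  even-case : ∀ j A fk fn → IsFloor (ι j ⊗ φ) A → IsFloor (ι (+ 2 ℤ.* j) ⊗ φ) fk → IsFloor (ι (A ℤ.+ + 2 ℤ.* j) ⊗ φ) fn →
              EvenB (residual (ι (A ℤ.+ + 2 ℤ.* j) ⊗ φ) fn (ι (+ 2 ℤ.* j) ⊗ φ) fk)
  even-case j A fk fn jφ≥A kφ≥fk nφ≥fn =
    subst EvenB (sym (trans (cong₂ (λ y x → residual y fn x fk) nφ≡ kφ≡) (residual-translate (+ 3 ℤ.* A ℤ.+ j) (coef ⊗ u) fn (+ 2 ℤ.* A) u fk)))
      (even-residual u (fk ℤ.- + 2 ℤ.* A) (fn ℤ.- (+ 3 ℤ.* A ℤ.+ j)) (proj₁ u-bounds) (proj₂ u-bounds)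
         (IsFloor-translate (+ 2 ℤ.* A) u fk (subst (λ x → IsFloor x fk) kφ≡ kφ≥fk))
         (IsFloor-translate (+ 3 ℤ.* A ℤ.+ j) (coef ⊗ u) fn (subst (λ x → IsFloor x fn) nφ≡ nφ≥fn)))
    where
      u = double-frac (ι j ⊗ φ) A
      u-bounds = double-frac-bounds (ι j ⊗ φ) A jφ≥A
      kφ≡ : ι (+ 2 ℤ.* j) ⊗ φ ≡ ι (+ 2 ℤ.* A) ⊕ u
      kφ≡ = subst₂ (λ K A₂ → K ⊗ φ ≡ A₂ ⊕ u) (sym (ι-2* j)) (sym (ι-2* A))
        (solve 2 (λ J A → con (ι (+ 2)) :* J :* con φ := con (ι (+ 2)) :* A :+ ((J :* con φ :- A) :+ (J :* con φ :- A))) refl (ι j) (ι A))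
      nφ≡ : ι (A ℤ.+ + 2 ℤ.* j) ⊗ φ ≡ ι (+ 3 ℤ.* A ℤ.+ j) ⊕ coef ⊗ u
      nφ≡ = subst₂ (λ N B → N ⊗ φ ≡ B ⊕ coef ⊗ u) (sym (ι-+2* A j)) (sym (ι-3*+ A j))
        (solve 2 (λ J A → (A :+ con (ι (+ 2)) :* J) :* con φ
                       := (con (ι (+ 3)) :* A :+ J) :+ con coef :* ((J :* con φ :- A) :+ (J :* con φ :- A))) refl (ι j) (ι A))

  odd-case : ∀ j A fk fn → IsFloor (ι j ⊗ φ) A → IsFloor (ι (+ 2 ℤ.* j ℤ.- + 1) ⊗ φ) fk →
             IsFloor (ι (A ℤ.+ + 2 ℤ.* j ℤ.- + 2) ⊗ φ) fn →
             OddB (residual (ι (A ℤ.+ + 2 ℤ.* j ℤ.- + 2) ⊗ φ) fn (ι (+ 2 ℤ.* j ℤ.- + 1) ⊗ φ) fk)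
  odd-case j A fk fn jφ≥A kφ≥fk nφ≥fn =
    subst OddB (sym (trans (cong₂ (λ y x → residual y fn x fk) nφ≡ kφ≡)
                           (residual-translate (+ 3 ℤ.* A ℤ.+ j) (coef ⊗ u ⊖ ι (+ 2) ⊗ φ) fn (+ 2 ℤ.* A) (u ⊖ φ) fk)))
      (odd-residual u (fk ℤ.- + 2 ℤ.* A) (fn ℤ.- (+ 3 ℤ.* A ℤ.+ j)) (proj₁ u-bounds) (proj₂ u-bounds)
         (IsFloor-translate (+ 2 ℤ.* A) (u ⊖ φ) fk (subst (λ x → IsFloor x fk) kφ≡ kφ≥fk))
         (IsFloor-translate (+ 3 ℤ.* A ℤ.+ j) (coef ⊗ u ⊖ ι (+ 2) ⊗ φ) fn (subst (λ x → IsFloor x fn) nφ≡ nφ≥fn)))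
    where
      u = double-frac (ι j ⊗ φ) A
      u-bounds = double-frac-bounds (ι j ⊗ φ) A jφ≥A
      kφ≡ : ι (+ 2 ℤ.* j ℤ.- + 1) ⊗ φ ≡ ι (+ 2 ℤ.* A) ⊕ (u ⊖ φ)
      kφ≡ = subst₂ (λ K A₂ → K ⊗ φ ≡ A₂ ⊕ (u ⊖ φ)) (sym (trans (ι-- (+ 2 ℤ.* j) (+ 1)) (cong (_⊖ ι (+ 1)) (ι-2* j)))) (sym (ι-2* A))
        (solve 2 (λ J A → (con (ι (+ 2)) :* J :- con (ι (+ 1))) :* con φ
                       := con (ι (+ 2)) :* A :+ (((J :* con φ :- A) :+ (J :* con φ :- A)) :- con φ)) refl (ι j) (ι A))
      nφ≡ : ι (A ℤ.+ + 2 ℤ.* j ℤ.- + 2) ⊗ φ ≡ ι (+ 3 ℤ.* A ℤ.+ j) ⊕ (coef ⊗ u ⊖ ι (+ 2) ⊗ φ)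
      nφ≡ = subst₂ (λ N B → N ⊗ φ ≡ B ⊕ (coef ⊗ u ⊖ ι (+ 2) ⊗ φ))
        (sym (trans (ι-- (A ℤ.+ + 2 ℤ.* j) (+ 2)) (cong (_⊖ ι (+ 2)) (ι-+2* A j)))) (sym (ι-3*+ A j))
        (solve 2 (λ J A → (A :+ con (ι (+ 2)) :* J :- con (ι (+ 2))) :* con φ
                       := (con (ι (+ 3)) :* A :+ J) :+ (con coef :* ((J :* con φ :- A) :+ (J :* con φ :- A)) :- con (ι (+ 2)) :* con φ))
               refl (ι j) (ι A))


open GoldenRatio using (⌊_φ⌋; ⌊φ⌋-IsFloor)
open SetS using (c; _≡_±1; InS⇒c±1; rank-c-1; rank-c+1)
open FractionalParts using (residual; residual-spec)
open Decomposition using (even-case; odd-case)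

odd-%2 : ∀ t → suc (t ℕ.+ t) % 2 ≡ 1
odd-%2 t = trans (cong (_% 2) (solve 1 (λ t → con 1 :+ (t :+ t) := con 1 :+ t :* con 2) refl t)) ([m+kn]%n≡m%n 1 t 2)
  where open ℕ-Solver.+-*-Solver

even-%2 : ∀ t → suc (suc (t ℕ.+ t)) % 2 ≡ 0
even-%2 t = trans (cong (_% 2) (solve 1 (λ t → con 2 :+ (t :+ t) := (con 1 :+ t) :* con 2) refl t)) (m*n%n≡0 (suc t) 2)
  where open ℕ-Solver.+-*-Solver

+[1+t+t]≡ : ∀ t → + suc (t ℕ.+ t) ≡ + 2 ℤ.* + suc t ℤ.- + 1
+[1+t+t]≡ t = trans (cong (λ i → + 1 ℤ.+ i) (ℤP.pos-+ t t))
  (solve 1 (λ t → con (+ 1) :+ (t :+ t) := con (+ 2) :* (con (+ 1) :+ t) :- con (+ 1)) refl (+ t))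
  where open ℤ-Solver.+-*-Solver

+[2+t+t]≡ : ∀ t → + suc (suc (t ℕ.+ t)) ≡ + 2 ℤ.* + suc t
+[2+t+t]≡ t = trans (cong (λ i → + 2 ℤ.+ i) (ℤP.pos-+ t t))
  (solve 1 (λ t → con (+ 2) :+ (t :+ t) := con (+ 2) :* (con (+ 1) :+ t)) refl (+ t))
  where open ℤ-Solver.+-*-Solver

cOf-1≡ : ∀ j A → cOf j A ℤ.- + 1 ≡ A ℤ.+ + 2 ℤ.* j ℤ.- + 2
cOf-1≡ j A = solve 2 (λ a j → (a :+ con (+ 2) :* j :- con (+ 1)) :- con (+ 1) := a :+ con (+ 2) :* j :- con (+ 2)) refl A j
  where open ℤ-Solver.+-*-Solver

cOf+1≡ : ∀ j A → cOf j A ℤ.+ + 1 ≡ A ℤ.+ + 2 ℤ.* j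
cOf+1≡ j A = solve 2 (λ a j → (a :+ con (+ 2) :* j :- con (+ 1)) :+ con (+ 1) := a :+ con (+ 2) :* j) refl A j
  where open ℤ-Solver.+-*-Solver

module _ (k : ℕ) (n fk fn : ℤ) (kφ≥fk : IsFloor (ι (+ k) ⊗ φ) fk) (nφ≥fn : IsFloor (ι n ⊗ φ) fn) where

  b : Q5
  b = residual (ι n ⊗ φ) fn (ι (+ k) ⊗ φ) fk

  b-transport : ∀ {P : Q5 → Set} K N → + k ≡ K → n ≡ N →
                (IsFloor (ι K ⊗ φ) fk → IsFloor (ι N ⊗ φ) fn → P (residual (ι N ⊗ φ) fn (ι K ⊗ φ) fk)) → P b
  b-transport _ _ refl refl case = case kφ≥fk nφ≥fn

  b-parity : KthSmallestS k n → (k % 2 ≡ 0 → EvenB b) × (k % 2 ≡ 1 → OddB b)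
  b-parity kth = by-index (InS⇒c±1 (proj₁ kth))
    where
      by-index : (∃ λ s → 1 ℕ.≤ s × n ≡ c s ±1) → (k % 2 ≡ 0 → EvenB b) × (k % 2 ≡ 1 → OddB b)
      by-index (suc t , _ , inj₁ n≡c-1) = (λ k%2≡0 → contradiction (trans (sym k%2≡0) k%2≡1) λ ()) , λ _ → odd
        where
          k≡ = rank-c-1 t (subst (KthSmallestS k) n≡c-1 kth)
          k%2≡1 = trans (cong (_% 2) k≡) (odd-%2 t)
          odd : OddB b
          odd = b-transport {OddB} _ _ (trans (cong +_ k≡) (+[1+t+t]≡ t)) (trans n≡c-1 (cOf-1≡ (+ suc t) ⌊ suc t φ⌋))
                  (odd-case (+ suc t) ⌊ suc t φ⌋ fk fn (⌊φ⌋-IsFloor (suc t)))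
      by-index (suc t , _ , inj₂ n≡c+1) = (λ _ → even) , λ k%2≡1 → contradiction (trans (sym k%2≡1) k%2≡0) λ ()
        where
          k≡ = rank-c+1 t (subst (KthSmallestS k) n≡c+1 kth)
          k%2≡0 = trans (cong (_% 2) k≡) (even-%2 t)
          even : EvenB b
          even = b-transport {EvenB} _ _ (trans (cong +_ k≡) (+[2+t+t]≡ t)) (trans n≡c+1 (cOf+1≡ (+ suc t) ⌊ suc t φ⌋))
                   (even-case (+ suc t) ⌊ suc t φ⌋ fk fn (⌊φ⌋-IsFloor (suc t)))

theorem4p6 : (k : ℕ) → 1 ℕ.≤ k → (n : ℤ) → KthSmallestS k n →
    (fk fn : ℤ) → IsFloor (ι (+ k) ⊗ φ) fk → IsFloor (ι n ⊗ φ) fn →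
    ∃ λ b → ((ι n ⊗ φ) ⊖ ι fn ≡ coef ⊗ ((ι (+ k) ⊗ φ) ⊖ ι fk) ⊕ b)
    × ((k % 2 ≡ 0 → EvenB b) × (k % 2 ≡ 1 → OddB b))
theorem4p6 k _ n kth fk fn kφ≥fk nφ≥fn =
  b k n fk fn kφ≥fk nφ≥fn ,
  residual-spec (ι n ⊗ φ) fn (ι (+ k) ⊗ φ) fk ,
  b-parity k n fk fn kφ≥fk nφ≥fn kth
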